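{- Let $r,s\ge1$ and let $B$ be the alphabet $\{a_1,\dots,a_r,b_1,\dots,b_s,c_1,\dots,c_{2r+2s}\}$. Define words $v=\prod_{i=1}^{r}c_{2i-1}a_ic_{2i}\cdot\prod_{i=r+1}^{r+s}c_{2i-1}b_{i-r}c_{2i}$, $\mathbf a=a_1\cdots a_r$, $\mathbf b=b_1\cdots b_s$, and for $S,T>0$, $X_{S,T}=(v^S\mathbf a v^S\mathbf b v^S)^T$. Then for every $k\ge0$ there exists $R$ such that for all $S,T\ge R$, $$X_{S,T}X_{S,T}\equiv_k X_{S,T}\,\mathbf a\,X_{S,T}.$$
   Context: For words $u,w$ over $B$, $u\equiv_k w$ means $u$ and $w$ satisfy exactly the same sentences of quantifier depth at most $k$ of $FO^2[<,\mathrm{bet}]$, the first-order logic over finite words using only two reusable variables, with $<$, unary letter predicates $c(x)$ and binary predicates $c(x,y)$ ($c\in B$) meaning some position strictly between $x$ and $y$ carries $c$. Products denote concatenation in increasing order of index. -}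

module Defs where

open import Data.Nat using (ℕ; zero; suc; _+_; _*_; _≤_; _<_; s≤s; z≤n; _⊔_; _⊓_)
open import Data.Nat.Properties using (≤-trans; <-trans; m≤m+n; *-monoʳ-≤; +-suc; ≤-refl; n<1+n; *-distribˡ-+; +-monoʳ-<)
open import Data.Fin using (Fin; toℕ; fromℕ<)
open import Data.Fin.Properties using (toℕ<n)
open import Data.List using (List; []; _∷_; _++_; concat; map; length; replicate)
open import Data.List.Base using (allFin)
open import Data.Maybe using (Maybe; just; nothing)
open import Data.Bool using (Bool; true; false; T)
open import Data.Product using (Σ; _×_; _,_)
open import Data.Sum using (_⊎_)
open import Relation.Binary.PropositionalEquality using (_≡_; sym)
open import Relation.Nullary using (¬_)
open import Function.Bundles using (_⇔_)

-- The alphabet B = {a_1..a_r, b_1..b_s, c_1..c_{2r+2s}} (0-based indices)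

data Letter (r s : ℕ) : Set where
  aL : Fin r → Letter r s
  bL : Fin s → Letter r s
  cL : Fin (2 * r + 2 * s) → Letter r s

Word : ℕ → ℕ → Set
Word r s = List (Letter r s)

data Var : Set where
  vx vy : Var

data Fm (A : Set) : Set where
  _<'_  : Var → Var → Fm A
  lab   : A → Var → Fm A
  bet   : A → Var → Var → Fm A
  ¬'_   : Fm A → Fm A
  _∧'_  : Fm A → Fm A → Fm A
  _∨'_  : Fm A → Fm A → Fm A
  ∃'    : Var → Fm A → Fm A

qd : {A : Set} → Fm A → ℕ
qd (_ <' _)   = 0
qd (lab _ _)  = 0
qd (bet _ _ _) = 0
qd (¬' φ)     = qd φ
qd (φ ∧' ψ)   = qd φ ⊔ qd ψ
qd (φ ∨' ψ)   = qd φ ⊔ qd ψ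
qd (∃' _ φ)   = suc (qd φ)

Scope : Set
Scope = Var → Bool

bind : Scope → Var → Scope
bind Γ vx vx = true
bind Γ vx vy = Γ vy
bind Γ vy vx = Γ vx
bind Γ vy vy = true

WellScoped : {A : Set} → Scope → Fm A → Set
WellScoped Γ (u <' v)    = T (Γ u) × T (Γ v)
WellScoped Γ (lab _ u)   = T (Γ u)
WellScoped Γ (bet _ u v) = T (Γ u) × T (Γ v)
WellScoped Γ (¬' φ)      = WellScoped Γ φ
WellScoped Γ (φ ∧' ψ)    = WellScoped Γ φ × WellScoped Γ ψ
WellScoped Γ (φ ∨' ψ)    = WellScoped Γ φ × WellScoped Γ ψ
WellScoped Γ (∃' v φ)    = WellScoped (bind Γ v) φ

Sentence : {A : Set} → Fm A → Set
Sentence φ = WellScoped (λ _ → false) φ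

-- Semantics over finite words; positions 0 .. length w - 1

letterAt : {A : Set} → List A → ℕ → Maybe A
letterAt []       _       = nothing
letterAt (a ∷ w)  zero    = just a
letterAt (a ∷ w)  (suc n) = letterAt w n

Val : Set
Val = Var → ℕ

upd : Val → Var → ℕ → Val
upd ρ vx p vx = p
upd ρ vx p vy = ρ vy
upd ρ vy p vx = ρ vx
upd ρ vy p vy = p

Sat : {A : Set} → List A → Val → Fm A → Set
Sat w ρ (u <' v)    = ρ u < ρ v
Sat w ρ (lab c u)   = letterAt w (ρ u) ≡ just c
Sat w ρ (bet c u v) = Σ ℕ λ z → (ρ u ⊓ ρ v) < z × z < (ρ u ⊔ ρ v) × letterAt w z ≡ just c
Sat w ρ (¬' φ)      = ¬ Sat w ρ φ
Sat w ρ (φ ∧' ψ)    = Sat w ρ φ × Sat w ρ ψ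
Sat w ρ (φ ∨' ψ)    = Sat w ρ φ ⊎ Sat w ρ ψ
Sat w ρ (∃' v φ)    = Σ ℕ λ p → p < length w × Sat w (upd ρ v p) φ

-- truth of a sentence (valuation irrelevant for sentences)
_⊨_ : {A : Set} → List A → Fm A → Set
w ⊨ φ = Sat w (λ _ → 0) φ

_≡[_]_ : {A : Set} → List A → ℕ → List A → Set
_≡[_]_ {A} u k w = (φ : Fm A) → Sentence φ → qd φ ≤ k → (u ⊨ φ) ⇔ (w ⊨ φ)

private
  dbl : ∀ {j n} → j < n → suc (2 * j) < 2 * n
  dbl {j} {suc n} (s≤s j≤n) rewrite +-suc n (n + 0) =
    s≤s (s≤s (*-monoʳ-≤ 2 j≤n))

  bnd : ∀ {j r s} → j < r + s → suc (2 * j) < 2 * r + 2 * s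
  bnd {j} {r} {s} p rewrite sym (*-distribˡ-+ 2 r s) = dbl p

-- For the block i = j+1 (0 ≤ j < r+s): c_{2i-1} has 0-based index 2j,
-- c_{2i} has 0-based index 2j+1.
cOdd cEven : ∀ {r s} (j : ℕ) → j < r + s → Letter r s
cOdd  {r} {s} j p = cL (fromℕ< (<-trans (n<1+n _) (bnd {j} {r} {s} p)))
cEven {r} {s} j p = cL (fromℕ< (bnd {j} {r} {s} p))

vW : (r s : ℕ) → Word r s
vW r s = concat (map blockA (allFin r)) ++ concat (map blockB (allFin s))
  where
  blockA : Fin r → Word r s
  blockA i = cOdd (toℕ i) pi ∷ aL i ∷ cEven (toℕ i) pi ∷ []
    where pi = ≤-trans (toℕ<n i) (m≤m+n r s)
  blockB : Fin s → Word r s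
  blockB i = cOdd (r + toℕ i) pi ∷ bL i ∷ cEven (r + toℕ i) pi ∷ []
    where pi = +-monoʳ-< r (toℕ<n i)

aW : (r s : ℕ) → Word r s
aW r s = map aL (allFin r)

bW : (r s : ℕ) → Word r s
bW r s = map bL (allFin s)

pow : {A : Set} → List A → ℕ → List A
pow w zero    = []
pow w (suc n) = w ++ pow w n

X : (r s S T : ℕ) → Word r s
X r s S T = pow (pow (vW r s) S ++ aW r s ++ pow (vW r s) S ++ bW r s ++ pow (vW r s) S) T

{-# OPTIONS --safe #-}

-- An Ehrenfeucht–Fraïssé argument for the two-pebble game of FO²[<,bet]. Every
-- D = 2|v| + |a| + |b| consecutive positions of X X and of X a X contain every letter, so a
-- bet-atom can separate two pebbles only when they are at most D apart, and then only through
-- the letters between them. With k rounds left Duplicator keeps every pebble matched: within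
-- (3k+3)|Y| positions of the left end the two positions coincide, within that distance of the
-- right end they differ by |a|, and in between they carry equal windows of radius (k+1)D.
-- A move within distance D of the other pebble is answered by the same shift; a far move is
-- answered by a position with the same window near the appropriate end, found through the
-- |Y|-periodicity of X X and the fact that the factor v^S a v^S around the inserted a also
-- occurs in X X. Each round consumes 3|Y| of margin and D of radius, and R pays for k rounds.

module Submission where

open import Defs
open import Data.Nat
open import Data.Nat.Properties
open import Data.Nat.DivMod using (m≡m%n+[m/n]*n; m%n<n)
open import Data.Nat.Tactic.RingSolver using (solve-∀)
open import Algebra.Properties.CommutativeSemigroup +-commutativeSemigroup using (x∙yz≈y∙xz; xy∙z≈xz∙y)
open import Data.Fin as Fin using (Fin; toℕ; fromℕ<)
open import Data.Fin.Properties using (toℕ<n; toℕ-fromℕ<; fromℕ<-cong; fromℕ<-toℕ)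
open import Data.List using (List; []; _∷_; _++_; length; concat; map; tabulate)
open import Data.List.Base using (allFin)
open import Data.List.Properties using (length-++; ++-assoc; ++-identityʳ; map-tabulate)
open import Data.Maybe using (just)
open import Data.Product using (Σ; ∃; _×_; _,_; proj₁; proj₂)
open import Data.Product.Function.NonDependent.Propositional using (_×-⇔_)
open import Data.Sum using (_⊎_; inj₁; inj₂)
open import Data.Sum.Function.Propositional using (_⊎-⇔_)
open import Data.Empty using (⊥-elim)
open import Function.Bundles using (_⇔_; mk⇔; Equivalence)
open import Function.Related.TypeIsomorphisms using (¬-cong-⇔)
open import Relation.Binary.PropositionalEquality
open import Relation.Nullary using (yes; no)
open ≡-Reasoning

module _ {A : Set} where

  letterAt-++ˡ : ∀ (xs ys : List A) {i} → i < length xs → letterAt (xs ++ ys) i ≡ letterAt xs i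
  letterAt-++ˡ (x ∷ xs) ys {zero}  _        = refl
  letterAt-++ˡ (x ∷ xs) ys {suc i} (s≤s i<) = letterAt-++ˡ xs ys i<

  letterAt-++ʳ : ∀ (xs ys : List A) i → letterAt (xs ++ ys) (length xs + i) ≡ letterAt ys i
  letterAt-++ʳ []       ys i = refl
  letterAt-++ʳ (x ∷ xs) ys i = letterAt-++ʳ xs ys i

  letterAt-just⇒< : ∀ (w : List A) i {c} → letterAt w i ≡ just c → i < length w
  letterAt-just⇒< (x ∷ w) zero    _ = s≤s z≤n
  letterAt-just⇒< (x ∷ w) (suc i) e = s≤s (letterAt-just⇒< w i e)

  <⇒letterAt-just : ∀ (w : List A) {i} → i < length w → ∃ λ c → letterAt w i ≡ just c
  <⇒letterAt-just (x ∷ w) {zero}  _        = x , refl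
  <⇒letterAt-just (x ∷ w) {suc i} (s≤s i<) = <⇒letterAt-just w i<

  record Agree (w w' : List A) (x x' len : ℕ) : Set where
    constructor agree
    field
      agree-at : ∀ j → j ≤ len → letterAt w (x + j) ≡ letterAt w' (x' + j)

  open Agree public

  agree-sub : ∀ {w w' x x' len} i {len'} → Agree w w' x x' len → i + len' ≤ len →
              Agree w w' (x + i) (x' + i) len'
  agree-sub {w} {w'} {x} {x'} i ag i+len'≤len = agree λ j j≤len' →
    subst₂ (λ u u' → letterAt w u ≡ letterAt w' u') (sym (+-assoc x i j)) (sym (+-assoc x' i j))
      (agree-at ag (i + j) (≤-trans (+-monoʳ-≤ i j≤len') i+len'≤len))

  agree-sym : ∀ {w w' x x' len} → Agree w w' x x' len → Agree w' w x' x len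
  agree-sym ag = agree λ j j≤ → sym (agree-at ag j j≤)

  agree-trans : ∀ {w w' w'' x x' x'' len} → Agree w w' x x' len → Agree w' w'' x' x'' len → Agree w w'' x x'' len
  agree-trans ag ag' = agree λ j j≤ → trans (agree-at ag j j≤) (agree-at ag' j j≤)

  Between : List A → A → ℕ → ℕ → Set
  Between w c x y = Σ ℕ λ z → x < z × z < y × letterAt w z ≡ just c

  OccursIn : List A → A → ℕ → ℕ → Set
  OccursIn w c q len = Σ ℕ λ z → q ≤ z × z < q + len × letterAt w z ≡ just c

  LettersDense : ℕ → List A → Set
  LettersDense D w = ∀ c q → q + D ≤ length w → OccursIn w c q D

  dense⇒between : ∀ {D} w c {x y} → LettersDense D w → x + D < y → y < length w → Between w c x y
  dense⇒between w c {x} dense x+D<y y<∣w∣ with dense c (suc x) (<-trans x+D<y y<∣w∣)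
  ... | z , x<z , z<x+D , e = z , x<z , ≤-trans z<x+D x+D<y , e

  between-ordered : ∀ w c {x y} → x ≤ y → Between w c (x ⊓ y) (x ⊔ y) ≡ Between w c x y
  between-ordered w c x≤y rewrite m≤n⇒m⊓n≡m x≤y | m≤n⇒m⊔n≡n x≤y = refl

  between-comm : ∀ w c x y → Between w c (x ⊓ y) (x ⊔ y) ≡ Between w c (y ⊓ x) (y ⊔ x)
  between-comm w c x y rewrite ⊓-comm x y | ⊔-comm x y = refl

<+⇒<+ : ∀ x x' {j} → x < x + j → x' < x' + j
<+⇒<+ x x' {j} h = subst (_< x' + j) (+-identityʳ x')
  (+-monoʳ-< x' (+-cancelˡ-< x 0 j (subst (_< x + j) (sym (+-identityʳ x)) h)))

module TwoPebbleGame {A : Set} (U W : List A) (D : ℕ) where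

  record Close (x y x' y' : ℕ) : Set where
    constructor close
    field
      gap   : ℕ
      gap≤D : gap ≤ D
      y≡    : y ≡ x + gap
      y'≡   : y' ≡ x' + gap
      segment : Agree U W x x' gap

  data Linked (x y x' y' : ℕ) : Set where
    near≤ : Close x y x' y' → Linked x y x' y'
    near≥ : Close y x y' x' → Linked x y x' y'
    far<  : x + D < y → x' + D < y' → Linked x y x' y'
    far>  : y + D < x → y' + D < x' → Linked x y x' y'

  Linked-sym : ∀ {x y x' y'} → Linked x y x' y' → Linked y x y' x'
  Linked-sym (near≤ c)   = near≥ c
  Linked-sym (near≥ c)   = near≤ c
  Linked-sym (far< h h') = far> h h'
  Linked-sym (far> h h') = far< h h'

  Linked-refl : ∀ {x x'} → letterAt U x ≡ letterAt W x' → Linked x x x' x'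
  Linked-refl {x} {x'} e = near≤ (close 0 z≤n (sym (+-identityʳ x)) (sym (+-identityʳ x')) (agree agree-0))
    where
    agree-0 : ∀ j → j ≤ 0 → letterAt U (x + j) ≡ letterAt W (x' + j)
    agree-0 zero z≤n rewrite +-identityʳ x | +-identityʳ x' = e

  Linked-< : ∀ {x y x' y'} → Linked x y x' y' → (x < y) ⇔ (x' < y')
  Linked-< {x} {_} {x'} (near≤ (close _ _ refl refl _)) =
    mk⇔ (<+⇒<+ x x') (<+⇒<+ x' x)
  Linked-< {_} {y} {_} {y'} (near≥ (close d _ refl refl _)) =
    mk⇔ (λ h → ⊥-elim (<⇒≱ h (m≤m+n y d))) (λ h → ⊥-elim (<⇒≱ h (m≤m+n y' d)))
  Linked-< (far< h h') =
    mk⇔ (λ _ → ≤-<-trans (m≤m+n _ D) h') (λ _ → ≤-<-trans (m≤m+n _ D) h)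
  Linked-< (far> h h') =
    mk⇔ (λ x<y → ⊥-elim (<⇒≱ x<y (<⇒≤ (≤-<-trans (m≤m+n _ D) h))))
        (λ x<y → ⊥-elim (<⇒≱ x<y (<⇒≤ (≤-<-trans (m≤m+n _ D) h'))))

  close-between : ∀ c {x y x' y'} → Close x y x' y' → Between U c x y ⇔ Between W c x' y'
  close-between c (close d _ refl refl ag) = mk⇔ (transport U W ag) (transport W U (agree-sym ag))
    where
    transport : ∀ w w' {u u'} → Agree w w' u u' d →
                Between w c u (u + d) → Between w' c u' (u' + d)
    transport w w' {u} {u'} ag (z , u<z , z<u+d , e) with m≤n⇒∃[o]m+o≡n (<⇒≤ u<z)
    ... | j , refl = u' + j , <+⇒<+ u u' u<z , +-monoʳ-< u' j<d , trans (sym (agree-at ag j (<⇒≤ j<d))) e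
      where j<d = +-cancelˡ-< u j d z<u+d

  -- Duplicator's strategy in the K-round two-pebble game: Match k relates a position of U and one
  -- of W that a single pebble may occupy with k rounds left.
  record Strategy (K : ℕ) : Set₁ where
    field
      Match        : ℕ → ℕ → ℕ → Set
      match-letter : ∀ {k y y'} → k ≤ K → Match k y y' → letterAt U y ≡ letterAt W y'
      match-<      : ∀ {k y y'} → Match k y y' → y < length U
      weaken       : ∀ {k y y'} → suc k ≤ K → Match (suc k) y y' → Match k y y'
      forth        : ∀ {k y y' p} → suc k ≤ K → Match (suc k) y y' → p < length U →
                     ∃ λ p' → Match k p p' × Linked p y p' y'
      back         : ∀ {k y y' p'} → suc k ≤ K → Match (suc k) y y' → p' < length W →
                     ∃ λ p → Match k p p' × Linked p y p' y'
      start        : Match K 0 0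

  module _ (denseU : LettersDense D U) (denseW : LettersDense D W) where

    private
      ordered : ∀ {c x y x' y'} → x ≤ y → x' ≤ y' → Between U c x y ⇔ Between W c x' y' →
                Between U c (x ⊓ y) (x ⊔ y) ⇔ Between W c (x' ⊓ y') (x' ⊔ y')
      ordered {c} h h' = subst₂ _⇔_ (sym (between-ordered U c h)) (sym (between-ordered W c h'))

      swapped : ∀ {c x y x' y'} → Between U c (y ⊓ x) (y ⊔ x) ⇔ Between W c (y' ⊓ x') (y' ⊔ x') →
                Between U c (x ⊓ y) (x ⊔ y) ⇔ Between W c (x' ⊓ y') (x' ⊔ y')
      swapped {c} {x} {y} {x'} {y'} = subst₂ _⇔_ (between-comm U c y x) (between-comm W c y' x')

      far-between : ∀ c {x y x' y'} → y < length U → y' < length W → x + D < y → x' + D < y' →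
                    Between U c x y ⇔ Between W c x' y'
      far-between c y< y'< h h' =
        mk⇔ (λ _ → dense⇒between W c denseW h' y'<) (λ _ → dense⇒between U c denseU h y<)

    Linked-between : ∀ c {x y x' y'} → x < length U → y < length U → x' < length W → y' < length W →
      Linked x y x' y' → Between U c (x ⊓ y) (x ⊔ y) ⇔ Between W c (x' ⊓ y') (x' ⊔ y')
    Linked-between c _ _ _ _ (near≤ cl@(close d _ refl refl _)) =
      ordered (m≤m+n _ d) (m≤m+n _ d) (close-between c cl)
    Linked-between c _ _ _ _ (near≥ cl@(close d _ refl refl _)) =
      swapped (ordered (m≤m+n _ d) (m≤m+n _ d) (close-between c cl))
    Linked-between c _ y< _ y'< (far< h h') =
      ordered (<⇒≤ (≤-<-trans (m≤m+n _ D) h)) (<⇒≤ (≤-<-trans (m≤m+n _ D) h')) (far-between c y< y'< h h')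
    Linked-between c x< _ x'< _ (far> h h') =
      swapped (ordered (<⇒≤ (≤-<-trans (m≤m+n _ D) h)) (<⇒≤ (≤-<-trans (m≤m+n _ D) h'))
                       (far-between c x< x'< h h'))

    module _ {K : ℕ} (S : Strategy K) where

      open Strategy S

      match-<′ : ∀ {k y y'} → k ≤ K → Match k y y' → y' < length W
      match-<′ k≤K m with <⇒letterAt-just U (match-< m)
      ... | c , e = letterAt-just⇒< W _ (trans (sym (match-letter k≤K m)) e)

      Matched : ℕ → Val → Val → Set
      Matched k ρ ρ' = (∀ u → Match k (ρ u) (ρ' u)) × Linked (ρ vx) (ρ vy) (ρ' vx) (ρ' vy)

      matched-linked : ∀ {k ρ ρ'} → k ≤ K → Matched k ρ ρ' → ∀ u v → Linked (ρ u) (ρ v) (ρ' u) (ρ' v)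
      matched-linked k≤K (m , l) vx vx = Linked-refl (match-letter k≤K (m vx))
      matched-linked k≤K (m , l) vy vy = Linked-refl (match-letter k≤K (m vy))
      matched-linked k≤K (m , l) vx vy = l
      matched-linked k≤K (m , l) vy vx = Linked-sym l

      other : Var → Var
      other vx = vy
      other vy = vx

      matched-upd : ∀ {k ρ ρ' p p'} v → Match k p p' → Match k (ρ (other v)) (ρ' (other v)) →
                    Linked p (ρ (other v)) p' (ρ' (other v)) → Matched k (upd ρ v p) (upd ρ' v p')
      matched-upd vx m m' l = (λ { vx → m ; vy → m' }) , l
      matched-upd vy m m' l = (λ { vx → m' ; vy → m }) , Linked-sym l

      sat-⇔ : ∀ φ {k ρ ρ'} → k ≤ K → qd φ ≤ k → Matched k ρ ρ' → Sat U ρ φ ⇔ Sat W ρ' φ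
      sat-⇔ (u <' v)    k≤K _ mt = Linked-< (matched-linked k≤K mt u v)
      sat-⇔ (lab c u)   k≤K _ (m , _) = mk⇔ (trans (sym e)) (trans e)
        where e = match-letter k≤K (m u)
      sat-⇔ (bet c u v) k≤K _ mt@(m , _) =
        Linked-between c (match-< (m u)) (match-< (m v)) (match-<′ k≤K (m u)) (match-<′ k≤K (m v))
          (matched-linked k≤K mt u v)
      sat-⇔ (¬' φ)      k≤K q mt = ¬-cong-⇔ (sat-⇔ φ k≤K q mt)
      sat-⇔ (φ ∧' ψ)    k≤K q mt =
        sat-⇔ φ k≤K (m⊔n≤o⇒m≤o _ _ q) mt ×-⇔ sat-⇔ ψ k≤K (m⊔n≤o⇒n≤o _ _ q) mt
      sat-⇔ (φ ∨' ψ)    k≤K q mt =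
        sat-⇔ φ k≤K (m⊔n≤o⇒m≤o _ _ q) mt ⊎-⇔ sat-⇔ ψ k≤K (m⊔n≤o⇒n≤o _ _ q) mt
      sat-⇔ (∃' v φ) {suc k} {ρ} {ρ'} k<K (s≤s q) (m , _) = mk⇔ forth-∃ back-∃
        where
        k≤K = <⇒≤ k<K
        step : ∀ {p p'} → Match k p p' → Linked p (ρ (other v)) p' (ρ' (other v)) →
               Sat U (upd ρ v p) φ ⇔ Sat W (upd ρ' v p') φ
        step mp l = sat-⇔ φ k≤K q (matched-upd v mp (weaken k<K (m (other v))) l)
        forth-∃ : Sat U ρ (∃' v φ) → Sat W ρ' (∃' v φ)
        forth-∃ (p , p< , s) with forth k<K (m (other v)) p<
        ... | p' , mp , l = p' , match-<′ k≤K mp , Equivalence.to (step mp l) s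
        back-∃ : Sat W ρ' (∃' v φ) → Sat U ρ (∃' v φ)
        back-∃ (p' , p'< , s) with back k<K (m (other v)) p'<
        ... | p , mp , l = p , match-< mp , Equivalence.from (step mp l) s

      -- Both valuations start at position 0.
      strategy⇒≡ : U ≡[ K ] W
      strategy⇒≡ φ _ qd≤K = sat-⇔ φ ≤-refl qd≤K ((λ _ → start) , Linked-refl (match-letter ≤-refl start))

radius : ℕ → ℕ → ℕ
radius D zero    = D
radius D (suc k) = radius D k + D

blocks : ℕ → ℕ
blocks zero    = 3
blocks (suc k) = blocks k + 3

D≤radius : ∀ D k → D ≤ radius D k
D≤radius D zero    = ≤-refl
D≤radius D (suc k) = ≤-trans (D≤radius D k) (m≤m+n _ D)

radius-mono-≤ : ∀ D {k K} → k ≤ K → radius D k ≤ radius D K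
radius-mono-≤ D {zero}  {zero}  _       = ≤-refl
radius-mono-≤ D {zero}  {suc K} _       = ≤-trans (radius-mono-≤ D {zero} {K} z≤n) (m≤m+n _ D)
radius-mono-≤ D {suc k} {suc K} (s≤s h) = +-monoˡ-≤ D (radius-mono-≤ D h)

3≤blocks : ∀ k → 3 ≤ blocks k
3≤blocks zero    = ≤-refl
3≤blocks (suc k) = ≤-trans (3≤blocks k) (m≤m+n _ 3)

blocks-mono-≤ : ∀ {k K} → k ≤ K → blocks k ≤ blocks K
blocks-mono-≤ {zero}  {zero}  _       = ≤-refl
blocks-mono-≤ {zero}  {suc K} _       = ≤-trans (blocks-mono-≤ {zero} {K} z≤n) (m≤m+n _ 3)
blocks-mono-≤ {suc k} {suc K} (s≤s h) = +-monoˡ-≤ 3 (blocks-mono-≤ h)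

near-or-far : ∀ p y D → p + D < y ⊎ y + D < p ⊎
              (∃ λ d → d ≤ D × p + d ≡ y) ⊎ (∃ λ d → d ≤ D × y + d ≡ p)
near-or-far p y D with ≤-total p y
... | inj₁ p≤y with m≤n⇒∃[o]m+o≡n p≤y
... | d , refl with d ≤? D
... | yes d≤D = inj₂ (inj₂ (inj₁ (d , d≤D , refl)))
... | no d≰D  = inj₁ (+-monoʳ-< p (≰⇒> d≰D))
near-or-far p y D | inj₂ y≤p with m≤n⇒∃[o]m+o≡n y≤p
... | d , refl with d ≤? D
... | yes d≤D = inj₂ (inj₂ (inj₂ (d , d≤D , refl)))
... | no d≰D  = inj₂ (inj₁ (+-monoʳ-< y (≰⇒> d≰D)))

3*n≡n+n+n : ∀ n → 3 * n ≡ n + n + n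
3*n≡n+n+n = solve-∀

∸-shiftʳ : ∀ {y} n D d → n + D ≤ y → y ∸ (n + D) + (D + d) ≡ y + d ∸ n
∸-shiftʳ n D d n+D≤y with m≤n⇒∃[o]m+o≡n n+D≤y
... | e , refl = begin
  n + D + e ∸ (n + D) + (D + d)  ≡⟨ cong (_+ (D + d)) (m+n∸m≡n (n + D) e) ⟩
  e + (D + d)                    ≡⟨ m+n∸m≡n n (e + (D + d)) ⟨
  n + (e + (D + d)) ∸ n          ≡⟨ cong (_∸ n) (rearrange n D e d) ⟩
  n + D + e + d ∸ n              ∎
  where
  rearrange : ∀ n D e d → n + (e + (D + d)) ≡ n + D + e + d
  rearrange = solve-∀

∸-shiftˡ : ∀ {y} n {D} d → n + D ≤ y → d ≤ D → y ∸ (n + D) + (D ∸ d) ≡ y ∸ d ∸ n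
∸-shiftˡ n d n+D≤y d≤D with m≤n⇒∃[o]m+o≡n d≤D
... | f , refl with m≤n⇒∃[o]m+o≡n n+D≤y
... | e , refl = begin
  n + (d + f) + e ∸ (n + (d + f)) + (d + f ∸ d)  ≡⟨ cong₂ _+_ (m+n∸m≡n (n + (d + f)) e) (m+n∸m≡n d f) ⟩
  e + f                                          ≡⟨ +-comm e f ⟩
  f + e                                          ≡⟨ m+n∸m≡n n (f + e) ⟨
  n + (f + e) ∸ n                                ≡⟨ cong (_∸ n) (m+n∸m≡n d (n + (f + e))) ⟨
  d + (n + (f + e)) ∸ d ∸ n                      ≡⟨ cong (λ z → z ∸ d ∸ n) (rearrange n d f e) ⟩
  n + (d + f) + e ∸ d ∸ n                        ∎
  where
  rearrange : ∀ n d f e → d + (n + (f + e)) ≡ n + (d + f) + e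
  rearrange = solve-∀

∸-+-∸ : ∀ {y n d} → d ≤ n → n ≤ y → y ∸ n + (n ∸ d) ≡ y ∸ d
∸-+-∸ {d = d} d≤n n≤y with m≤n⇒∃[o]m+o≡n d≤n
... | f , refl with m≤n⇒∃[o]m+o≡n n≤y
... | e , refl = begin
  d + f + e ∸ (d + f) + (d + f ∸ d)  ≡⟨ cong₂ _+_ (m+n∸m≡n (d + f) e) (m+n∸m≡n d f) ⟩
  e + f                              ≡⟨ +-comm e f ⟩
  f + e                              ≡⟨ m+n∸m≡n d (f + e) ⟨
  d + (f + e) ∸ d                    ≡⟨ cong (_∸ d) (+-assoc d f e) ⟨
  d + f + e ∸ d                      ∎

∸+-double : ∀ {x n} → n ≤ x → x ∸ n + (n + n) ≡ x + n
∸+-double {x} {n} n≤x = trans (sym (+-assoc (x ∸ n) n n)) (cong (_+ n) (m∸n+n≡m n≤x))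

-- U and W stand for X X and X a X: X has length σ = T·Ly and period Ly, and the factor
-- v^S a v^S (|v^S| = VL) around the middle of W also occurs at the start of U's second X.
module PeriodicGame {L : Set} (U W : List L) (T Ly la D VL K : ℕ) {{_ : NonZero Ly}}
  (∣U∣≡ : length U ≡ T * Ly + T * Ly)
  (∣W∣≡ : length W ≡ T * Ly + la + T * Ly)
  (prefix-agree : ∀ x → x < T * Ly → letterAt U x ≡ letterAt W x)
  (suffix-agree : ∀ i → letterAt U (T * Ly + i) ≡ letterAt W (T * Ly + la + i))
  (U-periodic : ∀ x q → x + q * Ly < T * Ly + T * Ly → letterAt U (x + q * Ly) ≡ letterAt U x)
  (seam-agree : ∀ i → i < VL + la + VL → letterAt W (T * Ly ∸ VL + i) ≡ letterAt U (T * Ly + i))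
  (denseU : LettersDense D U)
  (denseW : LettersDense D W)
  (2radius≤VL : radius D K + radius D K ≤ VL)
  (2VL+la≤Ly : VL + VL + la ≤ Ly)
  (blocks+3≤T : blocks K + 3 ≤ T)
  where

  open TwoPebbleGame U W D

  σ Lu Lw L₃ : ℕ
  σ  = T * Ly
  Lu = σ + σ
  Lw = σ + la + σ
  L₃ = Ly + Ly + Ly

  -- With k rounds left: N k is the radius of the windows compared in the interior, A k the width
  -- of the two end zones.
  N A : ℕ → ℕ
  N k = radius D k
  A k = blocks k * Ly

  VL≤Ly : VL ≤ Ly
  VL≤Ly = ≤-trans (m≤m+n VL VL) (≤-trans (m≤m+n _ la) 2VL+la≤Ly)

  2N≤VL : ∀ {k} → k ≤ K → N k + N k ≤ VL
  2N≤VL k≤K = ≤-trans (+-mono-≤ (radius-mono-≤ D k≤K) (radius-mono-≤ D k≤K)) 2radius≤VL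

  2N≤Ly : ∀ {k} → k ≤ K → N k + N k ≤ Ly
  2N≤Ly k≤K = ≤-trans (2N≤VL k≤K) VL≤Ly

  N≤Ly : ∀ {k} → k ≤ K → N k ≤ Ly
  N≤Ly k≤K = ≤-trans (m≤m+n _ _) (2N≤Ly k≤K)

  N-suc≤Ly : ∀ {k} → k ≤ K → N k + D ≤ Ly
  N-suc≤Ly {k} k≤K = ≤-trans (+-monoʳ-≤ (N k) (D≤radius D k)) (2N≤Ly k≤K)

  D≤Ly : D ≤ Ly
  D≤Ly = ≤-trans (D≤radius D 0) (N≤Ly z≤n)

  Ly≤L₃ : Ly ≤ L₃
  Ly≤L₃ = ≤-trans (m≤m+n Ly Ly) (m≤m+n _ Ly)

  A-suc : ∀ k → A (suc k) ≡ A k + L₃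
  A-suc k = trans (*-distribʳ-+ Ly (blocks k) 3) (cong (A k +_) (3*n≡n+n+n Ly))

  L₃≤A : ∀ k → L₃ ≤ A k
  L₃≤A k = subst (_≤ A k) (3*n≡n+n+n Ly) (*-monoˡ-≤ Ly (3≤blocks k))

  A+L₃≤σ : ∀ {k} → k ≤ K → A k + L₃ ≤ σ
  A+L₃≤σ {k} k≤K = subst (_≤ σ) (A-suc k) (*-monoˡ-≤ Ly (≤-trans (blocks-mono-≤ (s≤s k≤K)) blocks+3≤T))

  A+≤σ : ∀ {k x} → k ≤ K → x ≤ L₃ → A k + x ≤ σ
  A+≤σ k≤K x≤L₃ = ≤-trans (+-monoʳ-≤ _ x≤L₃) (A+L₃≤σ k≤K)

  A≤σ : ∀ {k} → k ≤ K → A k ≤ σ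
  A≤σ k≤K = ≤-trans (m≤m+n _ L₃) (A+L₃≤σ k≤K)

  N≤A : ∀ {k} → k ≤ K → N k ≤ A k
  N≤A {k} k≤K = ≤-trans (N≤Ly k≤K) (≤-trans Ly≤L₃ (L₃≤A k))

  A≤⇒N≤ : ∀ {k y} → k ≤ K → A k ≤ y → N k ≤ y
  A≤⇒N≤ k≤K A≤y = ≤-trans (N≤A k≤K) A≤y

  +A<⇒+N< : ∀ {k y M} → k ≤ K → y + A k < M → y + N k < M
  +A<⇒+N< {y = y} k≤K y+A<M = ≤-<-trans (+-monoʳ-≤ y (N≤A k≤K)) y+A<M

  A≤A-suc : ∀ k → A k ≤ A (suc k)
  A≤A-suc k = subst (A k ≤_) (sym (A-suc k)) (m≤m+n _ _)

  A+≤A-suc : ∀ k {x} → x ≤ L₃ → A k + x ≤ A (suc k)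
  A+≤A-suc k {x} x≤L₃ = subst (A k + x ≤_) (sym (A-suc k)) (+-monoʳ-≤ (A k) x≤L₃)

  Ly≤σ : Ly ≤ σ
  Ly≤σ = ≤-trans Ly≤L₃ (≤-trans (m≤n+m L₃ (A 0)) (A+L₃≤σ z≤n))

  Lu≤Lw : Lu ≤ Lw
  Lu≤Lw = +-monoˡ-≤ σ (m≤m+n σ la)

  +la<Lw : ∀ {x} → x < Lu → x + la < Lw
  +la<Lw {x} x<Lu = subst (x + la <_) (xy∙z≈xz∙y σ σ la) (+-monoˡ-< la x<Lu)

  low-bound : ∀ {k y x} → suc k ≤ K → y < A (suc k) → x ≤ L₃ → y + x < σ
  low-bound k<K y<A x≤L₃ = <-≤-trans (+-mono-<-≤ y<A x≤L₃) (A+L₃≤σ k<K)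

  high-bound : ∀ {k y x} → suc k ≤ K → Lu ≤ y + A (suc k) → x ≤ L₃ → σ + x ≤ y
  high-bound {k} {y} {x} k<K h x≤L₃ =
    +-cancelʳ-≤ (A (suc k)) (σ + x) y (≤-trans (≤-reflexive (+-assoc σ x _))
      (≤-trans (+-monoʳ-≤ σ (subst (_≤ σ) (+-comm (A (suc k)) x) (A+≤σ k<K x≤L₃))) h))

  suffix-agree′ : ∀ y → σ ≤ y → letterAt U y ≡ letterAt W (y + la)
  suffix-agree′ y σ≤y with m≤n⇒∃[o]m+o≡n σ≤y
  ... | e , refl = trans (suffix-agree e) (cong (letterAt W) (xy∙z≈xz∙y σ la e))

  prefix-agreeᴬ : ∀ {x len} → x + len < σ → Agree U W x x len
  prefix-agreeᴬ {x} h = agree λ j j≤len → prefix-agree (x + j) (≤-<-trans (+-monoʳ-≤ x j≤len) h)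

  suffix-agreeᴬ : ∀ {x len} → σ ≤ x → Agree U W x (x + la) len
  suffix-agreeᴬ {x} σ≤x = agree λ j _ →
    trans (suffix-agree′ (x + j) (≤-trans σ≤x (m≤m+n x j))) (cong (letterAt W) (xy∙z≈xz∙y x j la))

  Window : ℕ → ℕ → ℕ → Set
  Window n p p' = Agree U W (p ∸ n) (p' ∸ n) (n + n)

  window-prefix : ∀ {n p} → n ≤ p → p + n < σ → Window n p p
  window-prefix {n} n≤p h = prefix-agreeᴬ (subst (_< σ) (sym (∸+-double n≤p)) h)

  window-suffix : ∀ {n p} → σ + n ≤ p → Window n p (p + la)
  window-suffix {n} {p} σ+n≤p =
    subst (λ z → Agree U W (p ∸ n) z (n + n)) (sym (+-∸-comm la (≤-trans (m≤n+m n σ) σ+n≤p)))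
      (suffix-agreeᴬ (m+n≤o⇒m≤o∸n σ σ+n≤p))

  window-shiftʳ : ∀ {n y y'} d → d ≤ D → n + D ≤ y → n + D ≤ y' →
                  Window (n + D) y y' → Window n (y + d) (y' + d)
  window-shiftʳ {n} d d≤D hy hy' w =
    subst₂ (λ u u' → Agree U W u u' (n + n)) (∸-shiftʳ n D d hy) (∸-shiftʳ n D d hy')
      (agree-sub (D + d) w (≤-trans (+-monoˡ-≤ (n + n) (+-monoʳ-≤ D d≤D)) (≤-reflexive (rearrange n D))))
    where
    rearrange : ∀ n D → D + D + (n + n) ≡ n + D + (n + D)
    rearrange = solve-∀

  window-shiftˡ : ∀ {n y y'} d → d ≤ D → n + D ≤ y → n + D ≤ y' →
                  Window (n + D) y y' → Window n (y ∸ d) (y' ∸ d)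
  window-shiftˡ {n} d d≤D hy hy' w =
    subst₂ (λ u u' → Agree U W u u' (n + n)) (∸-shiftˡ n d hy d≤D) (∸-shiftˡ n d hy' d≤D)
      (agree-sub (D ∸ d) w (≤-trans (+-monoˡ-≤ (n + n) (m∸n≤m D d))
                                    (≤-trans (m≤m+n _ D) (≤-reflexive (rearrange n D)))))
    where
    rearrange : ∀ n D → D + (n + n) + D ≡ n + D + (n + D)
    rearrange = solve-∀

  window⇒agreeʳ : ∀ {n y y' d} → n ≤ y → n ≤ y' → d ≤ n → Window n y y' → Agree U W y y' d
  window⇒agreeʳ {n} {d = d} n≤y n≤y' d≤n w =
    subst₂ (λ u u' → Agree U W u u' d) (m∸n+n≡m n≤y) (m∸n+n≡m n≤y') (agree-sub n w (+-monoʳ-≤ n d≤n))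

  window⇒agreeˡ : ∀ {n y y' d} → n ≤ y → n ≤ y' → d ≤ n → Window n y y' →
                  Agree U W (y ∸ d) (y' ∸ d) d
  window⇒agreeˡ {n} {d = d} n≤y n≤y' d≤n w =
    subst₂ (λ u u' → Agree U W u u' d) (∸-+-∸ d≤n n≤y) (∸-+-∸ d≤n n≤y')
      (agree-sub (n ∸ d) w (≤-trans (≤-reflexive (m∸n+n≡m d≤n)) (m≤m+n n n)))

  periodic-agree : ∀ {r q q' len} → r + q * Ly + len < Lu → r + q' * Ly + len < Lu →
                   Agree U U (r + q * Ly) (r + q' * Ly) len
  periodic-agree {r} {q} {q'} {len} h h' =
    agree λ j j≤len → trans (unshift q h j j≤len) (sym (unshift q' h' j j≤len))
    where
    unshift : ∀ q → r + q * Ly + len < Lu → ∀ j → j ≤ len →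
              letterAt U (r + q * Ly + j) ≡ letterAt U (r + j)
    unshift q h j j≤len = trans (cong (letterAt U) (xy∙z≈xz∙y r (q * Ly) j))
      (U-periodic (r + j) q (subst (_< Lu) (xy∙z≈xz∙y r (q * Ly) j)
                                   (≤-<-trans (+-monoʳ-≤ (r + q * Ly) j≤len) h)))

  -- The position whose window of radius n starts in period block c at the same residue
  -- modulo Ly as the window of x.
  canonical : ℕ → ℕ → ℕ → ℕ
  canonical n c x = n + ((x ∸ n) % Ly + c * Ly)

  canonical-lower : ∀ n c x → c * Ly + n ≤ canonical n c x
  canonical-lower n c x = ≤-trans (≤-reflexive (+-comm (c * Ly) n)) (+-monoʳ-≤ n (m≤n+m (c * Ly) _))

  canonical-upper : ∀ n c x → canonical n c x < c * Ly + n + Ly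
  canonical-upper n c x = subst (canonical n c x <_) (rearrange n (c * Ly) Ly)
                            (+-monoʳ-< n (+-monoˡ-< (c * Ly) (m%n<n (x ∸ n) Ly)))
    where
    rearrange : ∀ n c l → n + (l + c) ≡ c + n + l
    rearrange = solve-∀

  window-canonical : ∀ n c {x} → n ≤ x → x + n < Lu → canonical n c x + n < Lu →
                     Agree U U (x ∸ n) (canonical n c x ∸ n) (n + n)
  window-canonical n c {x} n≤x x+n<Lu c+n<Lu =
    subst₂ (λ u u' → Agree U U u u' (n + n)) (sym (m≡m%n+[m/n]*n (x ∸ n) Ly)) (sym (m+n∸m≡n n (r + c * Ly)))
      (periodic-agree {r} {(x ∸ n) / Ly} {c} (subst (λ z → z + (n + n) < Lu) (m≡m%n+[m/n]*n (x ∸ n) Ly)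
                               (subst (_< Lu) (sym (∸+-double n≤x)) x+n<Lu))
                      (subst (_< Lu) (rearrange n (r + c * Ly)) c+n<Lu))
    where
    r = (x ∸ n) % Ly
    rearrange : ∀ n y → n + y + n ≡ y + (n + n)
    rearrange = solve-∀

  low-copy+N<σ : ∀ {k p} → k ≤ K → p < A k + N k + Ly → p + N k < σ
  low-copy+N<σ {k} k≤K p< = <-≤-trans (+-monoˡ-< (N k) p<)
    (≤-trans (≤-reflexive (rearrange (A k) (N k) Ly))
             (A+≤σ k≤K (≤-trans (+-monoˡ-≤ Ly (2N≤Ly k≤K)) (m≤m+n (Ly + Ly) Ly))))
    where
    rearrange : ∀ a n l → a + n + l + n ≡ a + (n + n + l)
    rearrange = solve-∀

  low-copy+A<Lu : ∀ {k p} → k ≤ K → p < A k + N k + Ly → p + A k < Lu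
  low-copy+A<Lu {k} {p} k≤K p< = +-mono-<-≤ (≤-<-trans (m≤m+n p (N k)) (low-copy+N<σ k≤K p<)) (A≤σ k≤K)

  low-copy+D≤A-suc : ∀ {k} → k ≤ K → A k + N k + Ly + D ≤ A (suc k)
  low-copy+D≤A-suc {k} k≤K = ≤-trans (≤-reflexive (rearrange (A k) (N k) Ly D))
    (A+≤A-suc k (≤-trans (+-monoˡ-≤ Ly (N-suc≤Ly k≤K)) (m≤m+n (Ly + Ly) Ly)))
    where
    rearrange : ∀ a n l d → a + n + l + d ≡ a + (n + d + l)
    rearrange = solve-∀

  left-copy : ∀ {k x} → k ≤ K → N k ≤ x → x + N k < Lu →
              ∃ λ p → A k ≤ p × p < A k + N k + Ly × Agree U U (x ∸ N k) (p ∸ N k) (N k + N k)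
  left-copy {k} {x} k≤K N≤x x+N<Lu =
    p , ≤-trans (m≤m+n (A k) n) (canonical-lower n (blocks k) x) , p< ,
    window-canonical n (blocks k) N≤x x+N<Lu (<-≤-trans (low-copy+N<σ k≤K p<) (m≤m+n σ σ))
    where
    n = N k
    p = canonical n (blocks k) x
    p< = canonical-upper n (blocks k) x

  split-double : ∀ t M e l → M + 2 + e ≡ t → (t + e) * l + (M * l + (l + l)) ≡ t * l + t * l
  split-double _ M e l refl = rearrange M e l
    where
    rearrange : ∀ M e l → (M + 2 + e + e) * l + (M * l + (l + l)) ≡ (M + 2 + e) * l + (M + 2 + e) * l
    rearrange = solve-∀

  right-block : ∀ {k} → k ≤ K → ∃ λ c → σ ≤ c * Ly × c * Ly + (A k + (Ly + Ly)) ≡ Lu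
  right-block {k} k≤K with m≤n⇒∃[o]m+o≡n blocks+2≤T
    where
    blocks+2≤T : blocks k + 2 ≤ T
    blocks+2≤T = ≤-trans (+-monoˡ-≤ 2 (blocks-mono-≤ k≤K)) (≤-trans (+-monoʳ-≤ (blocks K) (n≤1+n 2)) blocks+3≤T)
  ... | e , eq = T + e , *-monoˡ-≤ Ly (m≤m+n T e) , split-double T (blocks k) e Ly eq

  right-copy : ∀ {k x} → k ≤ K → N k ≤ x → x + N k < Lu →
               ∃ λ p → σ + N k ≤ p × p + A k < Lu × Lu ≤ p + (A k + (Ly + Ly)) ×
                       Agree U U (x ∸ N k) (p ∸ N k) (N k + N k)
  right-copy {k} {x} k≤K N≤x x+N<Lu with right-block k≤K
  ... | c , σ≤cLy , cLy+≡Lu =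
    p , ≤-trans (+-monoˡ-≤ n σ≤cLy) (canonical-lower n c x) , p+A<Lu ,
    subst (_≤ p + (A k + (Ly + Ly))) cLy+≡Lu
      (+-monoˡ-≤ (A k + (Ly + Ly)) (≤-trans (m≤m+n (c * Ly) n) (canonical-lower n c x))) ,
    window-canonical n c N≤x x+N<Lu (+A<⇒+N< k≤K p+A<Lu)
    where
    n = N k
    p = canonical n c x
    rearrange : ∀ c n l a → c + n + l + a ≡ c + (a + (n + l))
    rearrange = solve-∀
    p+A<Lu : p + A k < Lu
    p+A<Lu = subst (p + A k <_) cLy+≡Lu (<-≤-trans (+-monoˡ-< (A k) (canonical-upper n c x))
               (≤-trans (≤-reflexive (rearrange (c * Ly) n Ly (A k)))
                        (+-monoʳ-≤ (c * Ly) (+-monoʳ-≤ (A k) (+-monoˡ-≤ Ly (N≤Ly k≤K))))))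

  VL≤σ : VL ≤ σ
  VL≤σ = ≤-trans VL≤Ly Ly≤σ

  seam-agreeᴬ : ∀ {t len} → t + len < VL + la + VL → Agree U W (σ + t) (σ ∸ VL + t) len
  seam-agreeᴬ {t} h = agree λ j j≤len →
    subst₂ (λ u u' → letterAt U u ≡ letterAt W u') (sym (+-assoc σ t j)) (sym (+-assoc (σ ∸ VL) t j))
      (sym (seam-agree (t + j) (≤-<-trans (+-monoʳ-≤ t j≤len) h)))

  window-seam : ∀ {k p'} → k ≤ K → N k ≤ p' → σ ≤ p' + N k → p' < σ + la + N k →
                Window (N k) (p' + VL) p'
  window-seam {k} {p'} k≤K N≤p' σ≤p'+N p'< with m≤n⇒∃[o]m+o≡n σ≤g+VL
    where
    n = N k
    σ≤g+VL : σ ≤ p' ∸ n + VL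
    σ≤g+VL = ≤-trans σ≤p'+N (≤-trans (≤-reflexive (sym (∸+-double N≤p'))) (+-monoʳ-≤ (p' ∸ n) (2N≤VL k≤K)))
  ... | t , σ+t≡g+VL =
    subst₂ (λ u u' → Agree U W u u' (n + n))
      (trans σ+t≡g+VL (sym (+-∸-comm VL N≤p')))
      (trans (sym (+-∸-comm t VL≤σ)) (trans (cong (_∸ VL) σ+t≡g+VL) (m+n∸n≡m (p' ∸ n) VL)))
      (seam-agreeᴬ (<-≤-trans (+-monoˡ-< (n + n) t<la+VL)
                              (≤-trans (+-monoʳ-≤ (la + VL) (2N≤VL k≤K)) (≤-reflexive (rearrange la VL)))))
    where
    n = N k
    g<σ+la : p' ∸ n < σ + la
    g<σ+la = +-cancelʳ-< n _ _ (subst (_< σ + la + n) (sym (m∸n+n≡m N≤p')) p'<)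
    t<la+VL : t < la + VL
    t<la+VL = +-cancelˡ-< σ _ _ (subst₂ _<_ (sym σ+t≡g+VL) (+-assoc σ la VL) (+-monoˡ-< VL g<σ+la))
    rearrange : ∀ la VL → la + VL + VL ≡ VL + la + VL
    rearrange = solve-∀

  record Interior (k y y' : ℕ) : Set where
    constructor interior
    field
      A≤y     : A k ≤ y
      y+A<Lu  : y + A k < Lu
      A≤y'    : A k ≤ y'
      y'+A<Lw : y' + A k < Lw
      window  : Window (N k) y y'

  data Match (k y y' : ℕ) : Set where
    left  : y < A k → y < Lu → y' ≡ y → Match k y y'
    right : Lu ≤ y + A k → y < Lu → y' ≡ y + la → Match k y y'
    inner : Interior k y y' → Match k y y'

  match-<Lu : ∀ {k y y'} → Match k y y' → y < Lu
  match-<Lu (left _ y<Lu _)  = y<Lu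
  match-<Lu (right _ y<Lu _) = y<Lu
  match-<Lu (inner m)        = ≤-<-trans (m≤m+n _ _) (Interior.y+A<Lu m)

  match-< : ∀ {k y y'} → Match k y y' → y < length U
  match-< m = subst (_ <_) (sym ∣U∣≡) (match-<Lu m)

  right-zone⇒σ≤ : ∀ {k y} → k ≤ K → Lu ≤ y + A k → σ ≤ y
  right-zone⇒σ≤ {y = y} k≤K h = +-cancelʳ-≤ σ σ y (≤-trans h (+-monoʳ-≤ y (A≤σ k≤K)))

  match-letter : ∀ {k y y'} → k ≤ K → Match k y y' → letterAt U y ≡ letterAt W y'
  match-letter k≤K (left y<A _ refl)  = prefix-agree _ (<-≤-trans y<A (A≤σ k≤K))
  match-letter k≤K (right h _ refl)   = suffix-agree′ _ (right-zone⇒σ≤ k≤K h)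
  match-letter {y = y} {y'} k≤K (inner (interior A≤y _ A≤y' _ w)) =
    subst₂ (λ u u' → letterAt U u ≡ letterAt W u') (+-identityʳ y) (+-identityʳ y')
      (agree-at (window⇒agreeʳ (A≤⇒N≤ k≤K A≤y) (A≤⇒N≤ k≤K A≤y') z≤n w) 0 z≤n)

  match-prefix : ∀ {k p} → k ≤ K → p + N k < σ → Match k p p
  match-prefix {k} {p} k≤K p+N<σ with p <? A k
  ... | yes p<A = left p<A (<-≤-trans p<σ (m≤m+n σ σ)) refl
    where p<σ = ≤-<-trans (m≤m+n p (N k)) p+N<σ
  ... | no p≮A = inner (interior A≤p p+A<Lu A≤p (<-≤-trans p+A<Lu Lu≤Lw)
                                 (window-prefix (A≤⇒N≤ k≤K A≤p) p+N<σ))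
    where
    A≤p = ≮⇒≥ p≮A
    p+A<Lu = +-mono-<-≤ (≤-<-trans (m≤m+n p (N k)) p+N<σ) (A≤σ k≤K)

  match-suffix : ∀ {k p} → k ≤ K → σ + N k ≤ p → p < Lu → Match k p (p + la)
  match-suffix {k} {p} k≤K σ+N≤p p<Lu with Lu ≤? p + A k
  ... | yes h = right h p<Lu refl
  ... | no h = inner (interior A≤p p+A<Lu (≤-trans A≤p (m≤m+n p la))
                               (subst (_< Lw) (xy∙z≈xz∙y p (A k) la) (+la<Lw p+A<Lu)) (window-suffix σ+N≤p))
    where
    A≤p = ≤-trans (A≤σ k≤K) (≤-trans (m≤m+n σ (N k)) σ+N≤p)
    p+A<Lu = ≰⇒> h

  D≤L₃ : D ≤ L₃
  D≤L₃ = ≤-trans D≤Ly Ly≤L₃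

  N≤L₃ : ∀ {k} → k ≤ K → N k ≤ L₃
  N≤L₃ k≤K = ≤-trans (N≤Ly k≤K) Ly≤L₃

  N-suc≤L₃ : ∀ {k} → k ≤ K → N k + D ≤ L₃
  N-suc≤L₃ k≤K = ≤-trans (N-suc≤Ly k≤K) Ly≤L₃

  interior-shiftʳ : ∀ {k y y' d} → suc k ≤ K → d ≤ D →
                    Interior (suc k) y y' → Interior k (y + d) (y' + d)
  interior-shiftʳ {k} {d = d} k<K d≤D (interior A≤y y+A<Lu A≤y' y'+A<Lw w) =
    interior (raise A≤y) (lower y+A<Lu) (raise A≤y') (lower y'+A<Lw)
             (window-shiftʳ d d≤D (A≤⇒N≤ k<K A≤y) (A≤⇒N≤ k<K A≤y') w)
    where
    raise : ∀ {z} → A (suc k) ≤ z → A k ≤ z + d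
    raise h = ≤-trans (≤-trans (A≤A-suc k) h) (m≤m+n _ d)
    lower : ∀ {z M} → z + A (suc k) < M → z + d + A k < M
    lower {z} h = ≤-<-trans (≤-trans (≤-reflexive (+-assoc z d (A k)))
      (+-monoʳ-≤ z (subst (_≤ A (suc k)) (+-comm (A k) d) (A+≤A-suc k (≤-trans d≤D D≤L₃))))) h

  interior-shiftˡ : ∀ {k y y' d} → suc k ≤ K → d ≤ D →
                    Interior (suc k) y y' → Interior k (y ∸ d) (y' ∸ d)
  interior-shiftˡ {k} {d = d} k<K d≤D (interior A≤y y+A<Lu A≤y' y'+A<Lw w) =
    interior (raise A≤y) (lower y+A<Lu) (raise A≤y') (lower y'+A<Lw)
             (window-shiftˡ d d≤D (A≤⇒N≤ k<K A≤y) (A≤⇒N≤ k<K A≤y') w)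
    where
    raise : ∀ {z} → A (suc k) ≤ z → A k ≤ z ∸ d
    raise h = m+n≤o⇒m≤o∸n (A k) (≤-trans (A+≤A-suc k (≤-trans d≤D D≤L₃)) h)
    lower : ∀ {z M} → z + A (suc k) < M → z ∸ d + A k < M
    lower {z} h = ≤-<-trans (+-mono-≤ (m∸n≤m z d) (A≤A-suc k)) h

  near-moveʳ : ∀ {k y y' d} → suc k ≤ K → d ≤ D → Match (suc k) y y' → y + d < Lu →
               Match k (y + d) (y' + d) × Close y (y + d) y' (y' + d)
  near-moveʳ {k} {y} {d = d} k<K d≤D (left y<A _ refl) _ =
    match-prefix k≤K (subst (_< σ) (sym (+-assoc y d (N k))) (low-bound k<K y<A d+N≤L₃)) ,
    close d d≤D refl refl (prefix-agreeᴬ (low-bound k<K y<A (≤-trans d≤D D≤L₃)))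
    where
    k≤K = <⇒≤ k<K
    d+N≤L₃ : d + N k ≤ L₃
    d+N≤L₃ = ≤-trans (+-monoˡ-≤ (N k) d≤D) (subst (_≤ L₃) (+-comm (N k) D) (N-suc≤L₃ k≤K))
  near-moveʳ {k} {y} {d = d} k<K d≤D (right h _ refl) y+d<Lu =
    subst (Match k (y + d)) (xy∙z≈xz∙y y d la)
      (match-suffix k≤K (≤-trans (high-bound k<K h (N≤L₃ k≤K)) (m≤m+n y d)) y+d<Lu) ,
    close d d≤D refl refl (suffix-agreeᴬ (right-zone⇒σ≤ k<K h))
    where k≤K = <⇒≤ k<K
  near-moveʳ {k} {d = d} k<K d≤D (inner im) _ =
    inner (interior-shiftʳ k<K d≤D im) ,
    close d d≤D refl refl (window⇒agreeʳ (A≤⇒N≤ k<K A≤y) (A≤⇒N≤ k<K A≤y')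
                                         (≤-trans d≤D (D≤radius D (suc k))) window)
    where open Interior im

  near-moveˡ : ∀ {k y y' d} → suc k ≤ K → d ≤ D → Match (suc k) y y' → d ≤ y →
               Match k (y ∸ d) (y' ∸ d) × Close (y ∸ d) y (y' ∸ d) y'
  near-moveˡ {k} {y} {d = d} k<K d≤D (left y<A _ refl) d≤y =
    match-prefix k≤K (≤-<-trans (+-monoˡ-≤ (N k) (m∸n≤m y d)) (low-bound k<K y<A (N≤L₃ k≤K))) ,
    close d d≤D y≡ y≡ (prefix-agreeᴬ (subst (_< σ) y≡ (<-≤-trans y<A (A≤σ k<K))))
    where
    k≤K = <⇒≤ k<K
    y≡ = sym (m∸n+n≡m d≤y)
  near-moveˡ {k} {y} {d = d} k<K d≤D (right h y<Lu refl) d≤y =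
    subst (Match k (y ∸ d)) (sym (+-∸-comm la d≤y)) (match-suffix k≤K σ+N≤y∸d (≤-<-trans (m∸n≤m y d) y<Lu)) ,
    close d d≤D (sym (m∸n+n≡m d≤y)) (sym (m∸n+n≡m (≤-trans d≤y (m≤m+n y la))))
      (subst (λ z → Agree U W (y ∸ d) z d) (sym (+-∸-comm la d≤y))
             (suffix-agreeᴬ (≤-trans (m≤m+n σ (N k)) σ+N≤y∸d)))
    where
    k≤K = <⇒≤ k<K
    σ+N≤y∸d : σ + N k ≤ y ∸ d
    σ+N≤y∸d = m+n≤o⇒m≤o∸n (σ + N k)
      (≤-trans (≤-trans (≤-reflexive (+-assoc σ (N k) d)) (+-monoʳ-≤ σ (+-monoʳ-≤ (N k) d≤D)))
               (high-bound k<K h (N-suc≤L₃ k≤K)))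
  near-moveˡ {k} {d = d} k<K d≤D (inner im) d≤y =
    inner (interior-shiftˡ k<K d≤D im) ,
    close d d≤D (sym (m∸n+n≡m d≤y)) (sym (m∸n+n≡m (≤-trans d≤N N≤y')))
      (window⇒agreeˡ (A≤⇒N≤ k<K A≤y) N≤y' d≤N window)
    where
    open Interior im
    N≤y' = A≤⇒N≤ k<K A≤y'
    d≤N = ≤-trans d≤D (D≤radius D (suc k))

  weaken : ∀ {k y y'} → suc k ≤ K → Match (suc k) y y' → Match k y y'
  weaken {k} {y} {y'} k<K m = subst₂ (Match k) (+-identityʳ y) (+-identityʳ y')
    (proj₁ (near-moveʳ k<K z≤n m (subst (_< Lu) (sym (+-identityʳ y)) (match-<Lu m))))

  Lu≤⇒Lw≤ : ∀ {x a} → Lu ≤ x + a → Lw ≤ x + la + a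
  Lu≤⇒Lw≤ {x} {a} h = subst₂ _≤_ (xy∙z≈xz∙y σ σ la) (xy∙z≈xz∙y x a la) (+-monoˡ-≤ la h)

  Lw≤⇒Lu≤ : ∀ {z k} → k ≤ K → Lw ≤ z + A k → la ≤ z × Lu ≤ z ∸ la + A k
  Lw≤⇒Lu≤ {z} {k} k≤K h = la≤z , +-cancelʳ-≤ la _ _ (subst₂ _≤_ (xy∙z≈xz∙y σ la σ) z+A≡ h)
    where
    la≤z : la ≤ z
    la≤z = ≤-trans (m≤n+m la σ) (+-cancelʳ-≤ σ (σ + la) z (≤-trans h (+-monoʳ-≤ z (A≤σ k≤K))))
    z+A≡ : z + A k ≡ z ∸ la + A k + la
    z+A≡ = trans (cong (_+ A k) (sym (m∸n+n≡m la≤z))) (xy∙z≈xz∙y (z ∸ la) la (A k))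

  ∸la<Lu : ∀ {z} → la ≤ z → z < Lw → z ∸ la < Lu
  ∸la<Lu la≤z z<Lw = +-cancelʳ-< la _ _ (subst₂ _<_ (sym (m∸n+n≡m la≤z)) (xy∙z≈xz∙y σ la σ) z<Lw)

  canonical-left : ∀ {k p} → k ≤ K → A k ≤ p → p + A k < Lu →
                   ∃ λ p' → Match k p p' × p' < A k + N k + Ly
  canonical-left {k} {p} k≤K A≤p p+A<Lu with left-copy k≤K (A≤⇒N≤ k≤K A≤p) (+A<⇒+N< k≤K p+A<Lu)
  ... | p' , A≤p' , p'< , copy =
    p' , inner (interior A≤p p+A<Lu A≤p' (<-≤-trans (low-copy+A<Lu k≤K p'<) Lu≤Lw)
                         (agree-trans copy (window-prefix (A≤⇒N≤ k≤K A≤p') (low-copy+N<σ k≤K p'<)))) ,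
    p'<

  canonical-right : ∀ {k p} → k ≤ K → A k ≤ p → p + A k < Lu →
                    ∃ λ p' → Match k p p' × Lw ≤ p' + (A k + (Ly + Ly))
  canonical-right {k} {p} k≤K A≤p p+A<Lu with right-copy k≤K (A≤⇒N≤ k≤K A≤p) (+A<⇒+N< k≤K p+A<Lu)
  ... | x , σ+N≤x , x+A<Lu , Lu≤ , copy =
    x + la , inner (interior A≤p p+A<Lu (≤-trans A≤x (m≤m+n x la))
                             (subst (_< Lw) (xy∙z≈xz∙y x (A k) la) (+la<Lw x+A<Lu))
                             (agree-trans copy (window-suffix σ+N≤x))) ,
    Lu≤⇒Lw≤ {x} Lu≤
    where A≤x = ≤-trans (A≤σ k≤K) (≤-trans (m≤m+n σ (N k)) σ+N≤x)

  window-from-U : ∀ {k p'} → k ≤ K → A k ≤ p' → p' + A k < Lw →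
                  ∃ λ x → N k ≤ x × x + N k < Lu × Window (N k) x p'
  window-from-U {k} {p'} k≤K A≤p' p'+A<Lw with p' + N k <? σ
  ... | yes p'+N<σ = p' , N≤p' , <-≤-trans p'+N<σ (m≤m+n σ σ) , window-prefix N≤p' p'+N<σ
    where N≤p' = A≤⇒N≤ k≤K A≤p'
  ... | no p'+N≮σ with σ + la + N k ≤? p'
  ... | yes σ+la+N≤p' =
    x , ≤-trans (m≤n+m (N k) σ) σ+N≤x ,
    +A<⇒+N< k≤K (+-cancelʳ-< la _ _ (subst₂ _<_ x+A+la≡ (xy∙z≈xz∙y σ la σ) p'+A<Lw)) ,
    subst (λ z → Window (N k) x z) (m∸n+n≡m la≤p') (window-suffix σ+N≤x)
    where
    la≤p' = ≤-trans (m≤n+m la σ) (≤-trans (m≤m+n (σ + la) (N k)) σ+la+N≤p')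
    x = p' ∸ la
    σ+N≤x : σ + N k ≤ x
    σ+N≤x = m+n≤o⇒m≤o∸n (σ + N k) (subst (_≤ p') (xy∙z≈xz∙y σ la (N k)) σ+la+N≤p')
    x+A+la≡ : p' + A k ≡ x + A k + la
    x+A+la≡ = trans (cong (_+ A k) (sym (m∸n+n≡m la≤p'))) (xy∙z≈xz∙y x la (A k))
  ... | no σ+la+N≰p' =
    p' + VL , ≤-trans N≤p' (m≤m+n p' VL) , x+N<Lu ,
    window-seam k≤K N≤p' (≮⇒≥ p'+N≮σ) (≰⇒> σ+la+N≰p')
    where
    N≤p' = A≤⇒N≤ k≤K A≤p'
    rearrange : ∀ s l n v → s + l + n + (v + n) ≡ s + (l + v + (n + n))
    rearrange = solve-∀
    x+N<Lu : p' + VL + N k < Lu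
    x+N<Lu = ≤-<-trans (≤-reflexive (+-assoc p' VL (N k)))
      (<-≤-trans (+-monoˡ-< (VL + N k) (≰⇒> σ+la+N≰p'))
        (≤-trans (≤-reflexive (rearrange σ la (N k) VL))
          (+-monoʳ-≤ σ (≤-trans (+-monoʳ-≤ (la + VL) (2N≤VL k≤K))
            (≤-trans (≤-reflexive (+-comm (la + VL) VL)) (≤-trans (≤-reflexive (sym (+-assoc VL la VL)))
              (≤-trans (subst (_≤ Ly) (xy∙z≈xz∙y VL VL la) 2VL+la≤Ly) Ly≤σ)))))))

  canonical-left′ : ∀ {k p'} → k ≤ K → A k ≤ p' → p' + A k < Lw →
                    ∃ λ p → Match k p p' × p < A k + N k + Ly
  canonical-left′ {k} k≤K A≤p' p'+A<Lw with window-from-U k≤K A≤p' p'+A<Lw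
  ... | x , N≤x , x+N<Lu , w with left-copy k≤K N≤x x+N<Lu
  ... | p , A≤p , p< , copy =
    p , inner (interior A≤p (low-copy+A<Lu k≤K p<) A≤p' p'+A<Lw (agree-trans (agree-sym copy) w)) , p<

  canonical-right′ : ∀ {k p'} → k ≤ K → A k ≤ p' → p' + A k < Lw →
                     ∃ λ p → Match k p p' × Lu ≤ p + (A k + (Ly + Ly))
  canonical-right′ {k} k≤K A≤p' p'+A<Lw with window-from-U k≤K A≤p' p'+A<Lw
  ... | x , N≤x , x+N<Lu , w with right-copy k≤K N≤x x+N<Lu
  ... | p , σ+N≤p , p+A<Lu , Lu≤ , copy =
    p , inner (interior A≤p p+A<Lu A≤p' p'+A<Lw (agree-trans (agree-sym copy) w)) , Lu≤
    where A≤p = ≤-trans (A≤σ k≤K) (≤-trans (m≤m+n σ (N k)) σ+N≤p)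

  low-response : ∀ {k p} → k ≤ K → p + A k < Lu → ∃ λ p' → Match k p p' × p' + D < A (suc k)
  low-response {k} {p} k≤K p+A<Lu with p <? A k
  ... | yes p<A =
    p , left p<A (≤-<-trans (m≤m+n p (A k)) p+A<Lu) refl , <-≤-trans (+-monoˡ-< D p<A) (A+≤A-suc k D≤L₃)
  ... | no p≮A with canonical-left k≤K (≮⇒≥ p≮A) p+A<Lu
  ... | p' , m , p'< = p' , m , <-≤-trans (+-monoˡ-< D p'<) (low-copy+D≤A-suc k≤K)

  low-response′ : ∀ {k p'} → k ≤ K → p' + A k < Lw → ∃ λ p → Match k p p' × p + D < A (suc k)
  low-response′ {k} {p'} k≤K p'+A<Lw with p' <? A k
  ... | yes p'<A = p' , left p'<A (<-≤-trans p'<A (≤-trans (A≤σ k≤K) (m≤m+n σ σ))) refl ,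
                   <-≤-trans (+-monoˡ-< D p'<A) (A+≤A-suc k D≤L₃)
  ... | no p'≮A with canonical-left′ k≤K (≮⇒≥ p'≮A) p'+A<Lw
  ... | p , m , p< = p , m , <-≤-trans (+-monoˡ-< D p<) (low-copy+D≤A-suc k≤K)

  high-response : ∀ {k p} → k ≤ K → A k ≤ p → p < Lu →
                  ∃ λ p' → Match k p p' × Lw ≤ p' + (A k + (Ly + Ly))
  high-response {k} {p} k≤K A≤p p<Lu with Lu ≤? p + A k
  ... | yes h = p + la , right h p<Lu refl , Lu≤⇒Lw≤ {p} (≤-trans h (+-monoʳ-≤ p (m≤m+n (A k) (Ly + Ly))))
  ... | no h = canonical-right k≤K A≤p (≰⇒> h)

  high-response′ : ∀ {k p'} → k ≤ K → A k ≤ p' → p' < Lw →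
                   ∃ λ p → Match k p p' × Lu ≤ p + (A k + (Ly + Ly))
  high-response′ {k} {p'} k≤K A≤p' p'<Lw with Lw ≤? p' + A k
  ... | yes h with Lw≤⇒Lu≤ k≤K h
  ... | la≤p' , Lu≤ = p' ∸ la , right Lu≤ (∸la<Lu la≤p' p'<Lw) (sym (m∸n+n≡m la≤p')) ,
                      ≤-trans Lu≤ (+-monoʳ-≤ (p' ∸ la) (m≤m+n (A k) (Ly + Ly)))
  high-response′ {k} {p'} k≤K A≤p' p'<Lw | no h = canonical-right′ k≤K A≤p' (≰⇒> h)

  above : ∀ {k y p M} → y + A (suc k) < M → M ≤ p + (A k + (Ly + Ly)) → y + D < p
  above {k} {y} {p} {M} h h' = ≤-<-trans (+-monoʳ-≤ y D≤Ly)
    (+-cancelʳ-< (A k + (Ly + Ly)) (y + Ly) p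
      (subst (_< p + (A k + (Ly + Ly))) (rearrange y (A k) Ly) (<-≤-trans (subst (λ z → y + z < M) (A-suc k) h) h')))
    where
    rearrange : ∀ y a l → y + (a + (l + l + l)) ≡ y + l + (a + (l + l))
    rearrange = solve-∀

  +A-suc< : ∀ k {x y M} → x ≤ y → y + A (suc k) < M → x + A k < M
  +A-suc< k x≤y h = ≤-<-trans (+-mono-≤ x≤y (A≤A-suc k)) h

  A-suc≤ : ∀ k {x y} → A (suc k) ≤ x → x ≤ y → A k ≤ y
  A-suc≤ k h x≤y = ≤-trans (A≤A-suc k) (≤-trans h x≤y)

  +D<⇒< : ∀ {x y} → x + D < y → x < y
  +D<⇒< {x} h = ≤-<-trans (m≤m+n x D) h

  +la-shift : ∀ {x y} → x + D < y → x + la + D < y + la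
  +la-shift {x} {y} h = subst (_< y + la) (xy∙z≈xz∙y x D la) (+-monoˡ-< la h)

  ∸la-shift : ∀ {x y} → la ≤ x → x + D < y + la → x ∸ la + D < y
  ∸la-shift {x} {y} la≤x h = +-cancelʳ-< la _ _
    (subst (_< y + la) (trans (cong (_+ D) (sym (m∸n+n≡m la≤x))) (xy∙z≈xz∙y (x ∸ la) la D)) h)

  left-zone+A<Lu : ∀ {k y} → suc k ≤ K → y < A (suc k) → y + A (suc k) < Lu
  left-zone+A<Lu k<K y<A = +-mono-<-≤ (<-≤-trans y<A (A≤σ k<K)) (A≤σ k<K)

  far-below : ∀ {k y y' p} → suc k ≤ K → Match (suc k) y y' → p < Lu → p + D < y →
              ∃ λ p' → Match k p p' × Linked p y p' y'
  far-below {k} {p = p} k<K (left y<A _ refl) _ p+D<y =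
    p , match-prefix (<⇒≤ k<K) (low-bound k<K (<-trans (+D<⇒< p+D<y) y<A) (N≤L₃ (<⇒≤ k<K))) ,
    far< p+D<y p+D<y
  far-below {k} {y} {p = p} k<K (right h _ refl) p<Lu p+D<y with Lu ≤? p + A k
  ... | yes h' = p + la , right h' p<Lu refl , far< p+D<y (+la-shift p+D<y)
  ... | no h' with low-response (<⇒≤ k<K) (≰⇒> h')
  ... | p' , m , p'+D<A =
    p' , m , far< p+D<y (<-≤-trans p'+D<A (≤-trans (A≤σ k<K) (≤-trans (right-zone⇒σ≤ k<K h) (m≤m+n y la))))
  far-below {k} {p = p} k<K (inner im) p<Lu p+D<y
    with low-response (<⇒≤ k<K) (+A-suc< k (<⇒≤ (+D<⇒< p+D<y)) (Interior.y+A<Lu im))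
  ... | p' , m , p'+D<A = p' , m , far< p+D<y (<-≤-trans p'+D<A (Interior.A≤y' im))

  far-above : ∀ {k y y' p} → suc k ≤ K → Match (suc k) y y' → p < Lu → y + D < p →
              ∃ λ p' → Match k p p' × Linked p y p' y'
  far-above {k} {y} {p = p} k<K (right h _ refl) p<Lu y+D<p =
    p + la , match-suffix (<⇒≤ k<K) (≤-trans (high-bound k<K h (N≤L₃ (<⇒≤ k<K))) (<⇒≤ (+D<⇒< y+D<p))) p<Lu ,
    far> y+D<p (+la-shift y+D<p)
  far-above {k} {p = p} k<K (left y<A _ refl) p<Lu y+D<p with p <? A k
  ... | yes p<A = p , left p<A p<Lu refl , far> y+D<p y+D<p
  ... | no p≮A with high-response (<⇒≤ k<K) (≮⇒≥ p≮A) p<Lu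
  ... | p' , m , Lw≤ = p' , m , far> y+D<p (above {k} (<-≤-trans (left-zone+A<Lu k<K y<A) Lu≤Lw) Lw≤)
  far-above {k} {y} {p = p} k<K (inner im) p<Lu y+D<p
    with high-response (<⇒≤ k<K) (A-suc≤ k (Interior.A≤y im) (<⇒≤ (+D<⇒< y+D<p))) p<Lu
  ... | p' , m , Lw≤ = p' , m , far> y+D<p (above {k} (Interior.y'+A<Lw im) Lw≤)

  far-below′ : ∀ {k y y' p'} → suc k ≤ K → Match (suc k) y y' → p' < Lw → p' + D < y' →
               ∃ λ p → Match k p p' × Linked p y p' y'
  far-below′ {k} {p' = p'} k<K (left y<A _ refl) _ p'+D<y =
    p' , match-prefix (<⇒≤ k<K) (low-bound k<K (<-trans (+D<⇒< p'+D<y) y<A) (N≤L₃ (<⇒≤ k<K))) ,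
    far< p'+D<y p'+D<y
  far-below′ {k} {y} {p' = p'} k<K (right h _ refl) p'<Lw p'+D<y' with Lw ≤? p' + A k
  ... | yes h' with Lw≤⇒Lu≤ (<⇒≤ k<K) h'
  ... | la≤p' , Lu≤ = p' ∸ la , right Lu≤ (∸la<Lu la≤p' p'<Lw) (sym (m∸n+n≡m la≤p')) ,
                      far< (∸la-shift la≤p' p'+D<y') p'+D<y'
  far-below′ {k} {y} {p' = p'} k<K (right h _ refl) p'<Lw p'+D<y' | no h'
    with low-response′ (<⇒≤ k<K) (≰⇒> h')
  ... | p , m , p+D<A = p , m , far< (<-≤-trans p+D<A (≤-trans (A≤σ k<K) (right-zone⇒σ≤ k<K h))) p'+D<y'
  far-below′ {k} {p' = p'} k<K (inner im) p'<Lw p'+D<y'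
    with low-response′ (<⇒≤ k<K) (+A-suc< k (<⇒≤ (+D<⇒< p'+D<y')) (Interior.y'+A<Lw im))
  ... | p , m , p+D<A = p , m , far< (<-≤-trans p+D<A (Interior.A≤y im)) p'+D<y'

  far-above′ : ∀ {k y y' p'} → suc k ≤ K → Match (suc k) y y' → p' < Lw → y' + D < p' →
               ∃ λ p → Match k p p' × Linked p y p' y'
  far-above′ {k} {y} {p' = p'} k<K (right h _ refl) p'<Lw y'+D<p' =
    p' ∸ la , subst (Match k (p' ∸ la)) (m∸n+n≡m la≤p') (match-suffix (<⇒≤ k<K) σ+N≤ (∸la<Lu la≤p' p'<Lw)) ,
    far> y+D< y'+D<p'
    where
    la≤p' = ≤-trans (m≤n+m la y) (≤-trans (m≤m+n (y + la) D) (<⇒≤ y'+D<p'))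
    y+D< : y + D < p' ∸ la
    y+D< = +-cancelʳ-< la _ _ (subst₂ _<_ (xy∙z≈xz∙y y la D) (sym (m∸n+n≡m la≤p')) y'+D<p')
    σ+N≤ = ≤-trans (high-bound k<K h (N≤L₃ (<⇒≤ k<K))) (<⇒≤ (+D<⇒< y+D<))
  far-above′ {k} {p' = p'} k<K (left y<A _ refl) p'<Lw y+D<p' with p' <? A k
  ... | yes p'<A =
    p' , left p'<A (<-≤-trans p'<A (≤-trans (A≤σ (<⇒≤ k<K)) (m≤m+n σ σ))) refl , far> y+D<p' y+D<p'
  ... | no p'≮A with high-response′ (<⇒≤ k<K) (≮⇒≥ p'≮A) p'<Lw
  ... | p , m , Lu≤ = p , m , far> (above {k} (left-zone+A<Lu k<K y<A) Lu≤) y+D<p'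
  far-above′ {k} {y' = y'} {p'} k<K (inner im) p'<Lw y'+D<p'
    with high-response′ (<⇒≤ k<K) (A-suc≤ k (Interior.A≤y' im) (<⇒≤ (+D<⇒< y'+D<p'))) p'<Lw
  ... | p , m , Lu≤ = p , m , far> (above {k} (Interior.y+A<Lu im) Lu≤) y'+D<p'

  d≤y'⇒d≤y : ∀ {k y y' d} → suc k ≤ K → Match (suc k) y y' → d ≤ D → d ≤ y' → d ≤ y
  d≤y'⇒d≤y k<K (left _ _ refl) _ d≤y' = d≤y'
  d≤y'⇒d≤y k<K (right h _ refl) d≤D _ = ≤-trans d≤D (≤-trans D≤Ly (≤-trans Ly≤σ (right-zone⇒σ≤ k<K h)))
  d≤y'⇒d≤y {k} k<K (inner im) d≤D _ = ≤-trans d≤D (≤-trans (D≤radius D (suc k)) (A≤⇒N≤ k<K (Interior.A≤y im)))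

  y'+d<Lw⇒y+d<Lu : ∀ {k y y' d} → suc k ≤ K → Match (suc k) y y' → d ≤ D → y' + d < Lw → y + d < Lu
  y'+d<Lw⇒y+d<Lu k<K (left y<A _ refl) d≤D _ = <-≤-trans (low-bound k<K y<A (≤-trans d≤D D≤L₃)) (m≤m+n σ σ)
  y'+d<Lw⇒y+d<Lu {y = y} {d = d} k<K (right _ _ refl) _ h =
    +-cancelʳ-< la _ _ (subst₂ _<_ (xy∙z≈xz∙y y la d) (xy∙z≈xz∙y σ la σ) h)
  y'+d<Lw⇒y+d<Lu {k} {y} k<K (inner im) d≤D _ =
    ≤-<-trans (+-monoʳ-≤ y (≤-trans d≤D (≤-trans (D≤radius D (suc k)) (N≤A k<K)))) (Interior.y+A<Lu im)

  forth : ∀ {k y y' p} → suc k ≤ K → Match (suc k) y y' → p < Lu →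
          ∃ λ p' → Match k p p' × Linked p y p' y'
  forth {k} {y} {y'} {p} k<K m p<Lu with near-or-far p y D
  ... | inj₁ p+D<y        = far-below k<K m p<Lu p+D<y
  ... | inj₂ (inj₁ y+D<p) = far-above k<K m p<Lu y+D<p
  ... | inj₂ (inj₂ (inj₁ (d , d≤D , refl))) with near-moveˡ k<K d≤D m (m≤n+m d p)
  ... | m' , c = y' ∸ d , subst (λ z → Match k z (y' ∸ d)) (m+n∸n≡m p d) m' ,
                 near≤ (subst (λ z → Close z (p + d) (y' ∸ d) y') (m+n∸n≡m p d) c)
  forth k<K m p<Lu | inj₂ (inj₂ (inj₂ (d , d≤D , refl))) with near-moveʳ k<K d≤D m p<Lu
  ... | m' , c = _ , m' , near≥ c

  back : ∀ {k y y' p'} → suc k ≤ K → Match (suc k) y y' → p' < Lw →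
         ∃ λ p → Match k p p' × Linked p y p' y'
  back {k} {y} {y'} {p'} k<K m p'<Lw with near-or-far p' y' D
  ... | inj₁ p'+D<y'        = far-below′ k<K m p'<Lw p'+D<y'
  ... | inj₂ (inj₁ y'+D<p') = far-above′ k<K m p'<Lw y'+D<p'
  ... | inj₂ (inj₂ (inj₁ (d , d≤D , refl)))
    with near-moveˡ k<K d≤D m (d≤y'⇒d≤y k<K m d≤D (m≤n+m d p'))
  ... | m' , c = y ∸ d , subst (Match k (y ∸ d)) (m+n∸n≡m p' d) m' ,
                 near≤ (subst (λ z → Close (y ∸ d) y z (p' + d)) (m+n∸n≡m p' d) c)
  back k<K m p'<Lw | inj₂ (inj₂ (inj₂ (d , d≤D , refl)))
    with near-moveʳ k<K d≤D m (y'+d<Lw⇒y+d<Lu k<K m d≤D p'<Lw)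
  ... | m' , c = _ , m' , near≥ c

  strategy : Strategy K
  strategy = record
    { Match        = Match
    ; match-letter = match-letter
    ; match-<      = match-<
    ; weaken       = weaken
    ; forth        = λ k<K m p< → forth k<K m (subst (_ <_) ∣U∣≡ p<)
    ; back         = λ k<K m p'< → back k<K m (subst (_ <_) ∣W∣≡ p'<)
    ; start        = left 0<A (<-≤-trans 0<A (≤-trans (A≤σ ≤-refl) (m≤m+n σ σ))) refl
    }
    where
    0<A : 0 < A K
    0<A = <-≤-trans (>-nonZero⁻¹ Ly) (≤-trans Ly≤L₃ (L₃≤A K))

  game-≡ : U ≡[ K ] W
  game-≡ = strategy⇒≡ denseU denseW strategy

module _ {A : Set} where

  letterAt-++ˡ-just : ∀ (xs ys : List A) {i c} → letterAt xs i ≡ just c → letterAt (xs ++ ys) i ≡ just c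
  letterAt-++ˡ-just xs ys {i} e = trans (letterAt-++ˡ xs ys (letterAt-just⇒< xs i e)) e

  occursAt : ∀ (w : List A) {z c} → letterAt w z ≡ just c → OccursIn w c z 1
  occursAt w {z} e = z , ≤-refl , subst (z <_) (+-comm 1 z) ≤-refl , e

  occursIn-++ˡ : ∀ (xs ys : List A) {c q len} → OccursIn xs c q len → OccursIn (xs ++ ys) c q len
  occursIn-++ˡ xs ys (z , q≤z , z< , e) = z , q≤z , z< , letterAt-++ˡ-just xs ys e

  occursIn-++ʳ : ∀ (xs ys : List A) {c q len} → OccursIn ys c q len → OccursIn (xs ++ ys) c (length xs + q) len
  occursIn-++ʳ xs ys {q = q} {len} (z , q≤z , z< , e) =
    length xs + z , +-monoʳ-≤ (length xs) q≤z ,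
    subst (length xs + z <_) (sym (+-assoc (length xs) q len)) (+-monoʳ-< (length xs) z<) ,
    trans (letterAt-++ʳ xs ys z) e

  occursIn-widen : ∀ (w : List A) {c q len q' len'} → q' ≤ q → q + len ≤ q' + len' →
                   OccursIn w c q len → OccursIn w c q' len'
  occursIn-widen w q'≤q bound (z , q≤z , z< , e) = z , ≤-trans q'≤q q≤z , <-≤-trans z< bound , e

  letterAt-common-prefix : ∀ (xs ys zs : List A) {i} → i < length xs → letterAt (xs ++ ys) i ≡ letterAt (xs ++ zs) i
  letterAt-common-prefix xs ys zs i< = trans (letterAt-++ˡ xs ys i<) (sym (letterAt-++ˡ xs zs i<))

  length-pow : ∀ (w : List A) n → length (pow w n) ≡ n * length w
  length-pow w zero    = refl
  length-pow w (suc n) = trans (length-++ w) (cong (length w +_) (length-pow w n))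

  pow-+ : ∀ (w : List A) m n → pow w m ++ pow w n ≡ pow w (m + n)
  pow-+ w zero    n = refl
  pow-+ w (suc m) n = trans (++-assoc w (pow w m) (pow w n)) (cong (w ++_) (pow-+ w m n))

  pow-suc-snoc : ∀ (w : List A) n → pow w (suc n) ≡ pow w n ++ w
  pow-suc-snoc w zero    = ++-identityʳ w
  pow-suc-snoc w (suc n) = trans (cong (w ++_) (pow-suc-snoc w n)) (sym (++-assoc w (pow w n) w))

  pow-periodic : ∀ (w : List A) n i → length w + i < n * length w →
                 letterAt (pow w n) (length w + i) ≡ letterAt (pow w n) i
  pow-periodic w (suc n) i h = begin
    letterAt (w ++ pow w n) (length w + i)  ≡⟨ letterAt-++ʳ w (pow w n) i ⟩
    letterAt (pow w n) i                    ≡⟨ letterAt-++ˡ (pow w n) w i< ⟨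
    letterAt (pow w n ++ w) i               ≡⟨ cong (λ u → letterAt u i) (pow-suc-snoc w n) ⟨
    letterAt (pow w (suc n)) i              ∎
    where
    i< : i < length (pow w n)
    i< = subst (i <_) (sym (length-pow w n)) (+-cancelˡ-< (length w) i _ h)

  pow-periodic* : ∀ (w : List A) n x q → x + q * length w < n * length w →
                  letterAt (pow w n) (x + q * length w) ≡ letterAt (pow w n) x
  pow-periodic* w n x zero    _ = cong (letterAt (pow w n)) (+-identityʳ x)
  pow-periodic* w n x (suc q) h = begin
    letterAt (pow w n) (x + (length w + q * length w))  ≡⟨ cong (letterAt (pow w n)) (x∙yz≈y∙xz x (length w) _) ⟩
    letterAt (pow w n) (length w + (x + q * length w))  ≡⟨ pow-periodic w n _ h' ⟩
    letterAt (pow w n) (x + q * length w)               ≡⟨ pow-periodic* w n x q (≤-<-trans (m≤n+m _ (length w)) h') ⟩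
    letterAt (pow w n) x                                ∎
    where
    h' : length w + (x + q * length w) < n * length w
    h' = subst (_< n * length w) (x∙yz≈y∙xz x (length w) _) h

  letterAt-concat-triples : ∀ {n} (f : Fin n → List A) → (∀ i → length (f i) ≡ 3) → ∀ i {o} → o < 3 →
                            letterAt (concat (map f (allFin n))) (3 * toℕ i + o) ≡ letterAt (f i) o
  letterAt-concat-triples f ∣f∣≡3 i o<3 rewrite map-tabulate (λ x → x) f = go f ∣f∣≡3 i o<3
    where
    go : ∀ {n} (g : Fin n → List A) → (∀ i → length (g i) ≡ 3) → ∀ i {o} → o < 3 →
         letterAt (concat (tabulate g)) (3 * toℕ i + o) ≡ letterAt (g i) o
    go g ∣g∣≡3 Fin.zero o<3 = letterAt-++ˡ (g Fin.zero) _ (subst (_ <_) (sym (∣g∣≡3 Fin.zero)) o<3)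
    go g ∣g∣≡3 (Fin.suc i) {o} o<3 = begin
      letterAt (concat (tabulate g)) (3 * suc (toℕ i) + o)
        ≡⟨ cong (letterAt (concat (tabulate g))) index ⟩
      letterAt (concat (tabulate g)) (length (g Fin.zero) + (3 * toℕ i + o))
        ≡⟨ letterAt-++ʳ (g Fin.zero) _ _ ⟩
      letterAt (concat (tabulate (λ x → g (Fin.suc x)))) (3 * toℕ i + o)
        ≡⟨ go (λ x → g (Fin.suc x)) (λ x → ∣g∣≡3 (Fin.suc x)) i o<3 ⟩
      letterAt (g (Fin.suc i)) o
        ∎
      where
      index : 3 * suc (toℕ i) + o ≡ length (g Fin.zero) + (3 * toℕ i + o)
      index = trans (cong (_+ o) (*-suc 3 (toℕ i)))
                    (trans (+-assoc 3 (3 * toℕ i) o) (cong (_+ (3 * toℕ i + o)) (sym (∣g∣≡3 Fin.zero))))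

even-or-odd : ∀ m → ∃ λ j → 2 * j ≡ m ⊎ suc (2 * j) ≡ m
even-or-odd zero    = 0 , inj₁ refl
even-or-odd (suc m) with even-or-odd m
... | j , inj₁ refl = j , inj₂ refl
... | j , inj₂ refl = suc j , inj₁ (*-suc 2 j)

module Alphabet (r s : ℕ) where

  blockA : Fin r → Word r s
  blockA i = cOdd (toℕ i) i< ∷ aL i ∷ cEven (toℕ i) i< ∷ []
    where i< = ≤-trans (toℕ<n i) (m≤m+n r s)

  blockB : Fin s → Word r s
  blockB i = cOdd (r + toℕ i) i< ∷ bL i ∷ cEven (r + toℕ i) i< ∷ []
    where i< = +-monoʳ-< r (toℕ<n i)

  -- vW r s unfolds definitionally to partA ++ partB.
  partA partB : Word r s
  partA = concat (map blockA (allFin r))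
  partB = concat (map blockB (allFin s))

  in-partA : ∀ i {o c} → o < 3 → letterAt (blockA i) o ≡ just c → letterAt (vW r s) (3 * toℕ i + o) ≡ just c
  in-partA i o<3 e = letterAt-++ˡ-just partA partB (trans (letterAt-concat-triples blockA (λ _ → refl) i o<3) e)

  in-partB : ∀ i {o c} → o < 3 → letterAt (blockB i) o ≡ just c →
             letterAt (vW r s) (length partA + (3 * toℕ i + o)) ≡ just c
  in-partB i o<3 e = trans (letterAt-++ʳ partA partB _) (trans (letterAt-concat-triples blockB (λ _ → refl) i o<3) e)

  D : ℕ
  D = length (vW r s) + length (vW r s) + length (aW r s) + length (bW r s)

  Occurs : Letter r s → Set
  Occurs c = ∃ λ o → letterAt (vW r s) o ≡ just c

  cOdd-cong : ∀ {j j'} (p : j' < r + s) (e : j ≡ j') → cOdd {r} {s} j (subst (_< r + s) (sym e) p) ≡ cOdd j' p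
  cOdd-cong p refl = refl

  cEven-cong : ∀ {j j'} (p : j' < r + s) (e : j ≡ j') → cEven {r} {s} j (subst (_< r + s) (sym e) p) ≡ cEven j' p
  cEven-cong p refl = refl

  brackets-occur : ∀ j (p : j < r + s) → Occurs (cOdd {r} {s} j p) × Occurs (cEven {r} {s} j p)
  brackets-occur j p with j <? r
  ... | yes j<r = (_ , in-partA i 0<3 (cong just (cOdd-cong p (toℕ-fromℕ< j<r)))) ,
                  (_ , in-partA i 2<3 (cong just (cEven-cong p (toℕ-fromℕ< j<r))))
    where
    i = fromℕ< j<r
    0<3 = s≤s z≤n
    2<3 = s≤s (s≤s (s≤s z≤n))
  ... | no j≮r with m≤n⇒∃[o]m+o≡n (≮⇒≥ j≮r)
  ... | t , refl = (_ , in-partB i 0<3 (cong just (cOdd-cong p r+i≡))) ,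
                   (_ , in-partB i 2<3 (cong just (cEven-cong p r+i≡)))
    where
    t<s = +-cancelˡ-< r t s p
    i = fromℕ< t<s
    r+i≡ = cong (r +_) (toℕ-fromℕ< t<s)
    0<3 = s≤s z≤n
    2<3 = s≤s (s≤s (s≤s z≤n))

  2*≤⇒< : ∀ (l : Fin (2 * r + 2 * s)) {j} → 2 * j ≤ toℕ l → j < r + s
  2*≤⇒< l {j} h = *-cancelˡ-< 2 j (r + s) (subst (2 * j <_) (sym (*-distribˡ-+ 2 r s)) (≤-<-trans h (toℕ<n l)))

  cL-fromℕ< : ∀ (l : Fin (2 * r + 2 * s)) {m} (e : m ≡ toℕ l) →
              cL {r} {s} (fromℕ< (subst (_< 2 * r + 2 * s) (sym e) (toℕ<n l))) ≡ cL l
  cL-fromℕ< l e = cong cL (trans (fromℕ<-cong _ _ e _ (toℕ<n l)) (fromℕ<-toℕ l (toℕ<n l)))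

  c-occurs : ∀ l → Occurs (cL {r} {s} l)
  c-occurs l with even-or-odd (toℕ l)
  ... | j , inj₁ e = subst Occurs (cL-fromℕ< l e) (proj₁ (brackets-occur j (2*≤⇒< l (≤-reflexive e))))
  ... | j , inj₂ e =
    subst Occurs (cL-fromℕ< l e) (proj₂ (brackets-occur j (2*≤⇒< l (≤-trans (n≤1+n _) (≤-reflexive e)))))

  every-letter-occurs : ∀ c → Occurs c
  every-letter-occurs (aL i) = _ , in-partA i (s≤s (s≤s z≤n)) refl
  every-letter-occurs (bL i) = _ , in-partB i (s≤s (s≤s z≤n)) refl
  every-letter-occurs (cL l) = c-occurs l

module Words (r s S T : ℕ) where

  open Alphabet r s

  v a b V Y Xw U W : Word r s
  v  = vW r s
  a  = aW r s
  b  = bW r s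
  V  = pow v S
  Y  = V ++ a ++ V ++ b ++ V
  Xw = pow Y T
  U  = Xw ++ Xw
  W  = Xw ++ a ++ Xw

  Lv la lb VL Ly : ℕ
  Lv = length v
  la = length a
  lb = length b
  VL = length V
  Ly = length Y

  occurs-in-v : ∀ c → OccursIn v c 0 Lv
  occurs-in-v c with every-letter-occurs c
  ... | o , e = o , z≤n , letterAt-just⇒< v o e , e

  next-copy : ∀ n {q o c} → q + Lv ≤ suc n * Lv → o < q → letterAt v o ≡ just c →
              letterAt (pow v n) o ≡ just c
  next-copy zero    {q} h o<q _ =
    ⊥-elim (<⇒≱ (≤-<-trans z≤n o<q) (+-cancelʳ-≤ Lv q 0 (subst (q + Lv ≤_) (+-identityʳ Lv) h)))
  next-copy (suc n) _   _   e = letterAt-++ˡ-just v (pow v n) e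

  occursIn-power : ∀ n c q → q + Lv ≤ n * Lv → OccursIn (pow v n) c q Lv
  occursIn-power zero c q h with occurs-in-v c
  ... | _ , _ , o<Lv , _ = ⊥-elim (<⇒≱ (≤-<-trans z≤n o<Lv) (≤-trans (m≤n+m Lv q) h))
  occursIn-power (suc n) c q h with Lv ≤? q
  ... | yes Lv≤q with m≤n⇒∃[o]m+o≡n Lv≤q
  ... | q' , refl =
    occursIn-++ʳ v (pow v n) (occursIn-power n c q' (+-cancelˡ-≤ Lv _ _ (subst (_≤ Lv + n * Lv) (+-assoc Lv q' Lv) h)))
  occursIn-power (suc n) c q h | no Lv≰q with occurs-in-v c
  ... | o , _ , o<Lv , e with q ≤? o
  ... | yes q≤o = occursIn-++ˡ v (pow v n) (o , q≤o , <-≤-trans o<Lv (m≤n+m Lv q) , e)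
  ... | no q≰o =
    occursIn-widen (v ++ pow v n) (≤-trans (<⇒≤ (≰⇒> Lv≰q)) (m≤m+n Lv o))
                   (subst₂ _≤_ (sym (trans (+-assoc Lv o 1) (cong (Lv +_) (+-comm o 1)))) (+-comm Lv q)
                           (+-monoʳ-≤ Lv (≰⇒> q≰o)))
                   (occursIn-++ʳ v (pow v n) (occursAt (pow v n) (next-copy n h (≰⇒> q≰o) e)))

  Dense : Word r s → Set
  Dense = LettersDense D

  StartsWithV : Word r s → Set
  StartsWithV Z = Z ≡ [] ⊎ ∃ λ Z' → Z ≡ v ++ Z'

  Lv≤D : Lv ≤ D
  Lv≤D = ≤-trans (m≤m+n Lv Lv) (≤-trans (m≤m+n _ la) (m≤m+n _ lb))

  straddle : ∀ {q le} → VL < q + Lv → le ≤ la + lb → VL + le + Lv < q + D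
  straddle {q} VL< le≤ = <-≤-trans (+-monoˡ-< Lv (+-mono-<-≤ VL< le≤)) (≤-reflexive (rearrange q Lv la lb))
    where
    rearrange : ∀ q l a b → q + l + (a + b) + l ≡ q + (l + l + a + b)
    rearrange = solve-∀

  dense-V++ : ∀ e Z → length e ≤ la + lb → Dense Z → StartsWithV Z → Dense (V ++ e ++ Z)
  dense-V++ e Z e≤ denseZ startZ c q q+D≤ with q + Lv ≤? VL
  ... | yes inV =
    occursIn-++ˡ V (e ++ Z) (occursIn-widen V ≤-refl (+-monoʳ-≤ q Lv≤D)
                                             (occursIn-power S c q (subst (q + Lv ≤_) (length-pow v S) inV)))
  ... | no inV̸ with VL + length e ≤? q
  ... | yes inZ with m≤n⇒∃[o]m+o≡n inZ
  ... | q' , refl =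
    subst (λ z → OccursIn (V ++ e ++ Z) c z D) (sym (+-assoc VL (length e) q'))
      (occursIn-++ʳ V (e ++ Z) (occursIn-++ʳ e Z (denseZ c q' (+-cancelˡ-≤ (VL + length e) _ _
        (subst₂ _≤_ (+-assoc (VL + length e) q' D) (trans ∣V++e++Z∣ (sym (+-assoc VL (length e) (length Z))))
                    q+D≤)))))
    where
    ∣V++e++Z∣ : length (V ++ e ++ Z) ≡ VL + (length e + length Z)
    ∣V++e++Z∣ = trans (length-++ V) (cong (VL +_) (length-++ e))
  dense-V++ e Z e≤ denseZ startZ c q q+D≤ | no inV̸ | no inZ̸ with startZ
  ... | inj₁ refl = ⊥-elim (<⇒≱ (≤-<-trans (m≤m+n _ Lv) (straddle (≰⇒> inV̸) e≤))
                                (≤-trans q+D≤ (≤-reflexive ∣V++e∣)))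
    where
    ∣V++e∣ : length (V ++ e ++ []) ≡ VL + length e
    ∣V++e∣ = trans (length-++ V) (cong (VL +_) (trans (length-++ e) (+-identityʳ (length e))))
  ... | inj₂ (Z' , refl) =
    occursIn-widen (V ++ e ++ v ++ Z') (≤-trans (<⇒≤ (≰⇒> inZ̸)) (≤-reflexive (sym VL+[e+0]≡)))
                   (≤-trans (≤-reflexive (cong (_+ Lv) VL+[e+0]≡)) (<⇒≤ (straddle (≰⇒> inV̸) e≤)))
                   (occursIn-++ʳ V _ (occursIn-++ʳ e _ (occursIn-++ˡ v Z' (occurs-in-v c))))
    where
    VL+[e+0]≡ : VL + (length e + 0) ≡ VL + length e
    VL+[e+0]≡ = cong (VL +_) (+-identityʳ (length e))

  pow-v-startsWithV : ∀ n R → 1 ≤ n → StartsWithV (pow v n ++ R)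
  pow-v-startsWithV (suc n) R _ = inj₂ (pow v n ++ R , ++-assoc v (pow v n) R)

  Y++≡ : ∀ R → Y ++ R ≡ V ++ a ++ V ++ b ++ V ++ R
  Y++≡ R = trans (++-assoc V _ R) (cong (V ++_) (trans (++-assoc a _ R)
             (cong (a ++_) (trans (++-assoc V _ R) (cong (V ++_) (++-assoc b V R))))))

  Y++-startsWithV : 1 ≤ S → ∀ R → StartsWithV (Y ++ R)
  Y++-startsWithV S≥1 R = subst StartsWithV (sym (Y++≡ R)) (pow-v-startsWithV S _ S≥1)

  dense-Y++ : 1 ≤ S → ∀ e R → length e ≤ la + lb → Dense R → StartsWithV R → Dense (Y ++ e ++ R)
  dense-Y++ S≥1 e R e≤ denseR startR = subst Dense (sym (Y++≡ (e ++ R)))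
    (dense-V++ a _ (m≤m+n la lb) (dense-V++ b _ (m≤n+m lb la) (dense-V++ e R e≤ denseR startR)
      (pow-v-startsWithV S _ S≥1)) (pow-v-startsWithV S _ S≥1))

  Y^n++-startsWithV : 1 ≤ S → ∀ n R → StartsWithV R → StartsWithV (pow Y n ++ R)
  Y^n++-startsWithV S≥1 zero    R startR = startR
  Y^n++-startsWithV S≥1 (suc n) R _      = subst StartsWithV (sym (++-assoc Y (pow Y n) R)) (Y++-startsWithV S≥1 _)

  dense-Y^n++ : 1 ≤ S → ∀ n R → Dense R → StartsWithV R → Dense (pow Y n ++ R)
  dense-Y^n++ S≥1 zero    R denseR _      = denseR
  dense-Y^n++ S≥1 (suc n) R denseR startR = subst Dense (sym (++-assoc Y (pow Y n) R))
    (dense-Y++ S≥1 [] _ z≤n (dense-Y^n++ S≥1 n R denseR startR) (Y^n++-startsWithV S≥1 n R startR))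

  dense-[] : Dense []
  dense-[] c q q+D≤0 with occurs-in-v c
  ... | _ , _ , o<Lv , _ = ⊥-elim (<⇒≱ (≤-<-trans z≤n o<Lv) (≤-trans Lv≤D (≤-trans (m≤n+m D q) q+D≤0)))

  Xw++ : 1 ≤ S → ∀ R → Dense R → StartsWithV R → Dense (Xw ++ R)
  Xw++ S≥1 = dense-Y^n++ S≥1 T

  dense-Xw : 1 ≤ S → Dense Xw
  dense-Xw S≥1 = subst Dense (++-identityʳ Xw) (Xw++ S≥1 [] dense-[] (inj₁ refl))

  Xw-startsWithV : 1 ≤ S → StartsWithV Xw
  Xw-startsWithV S≥1 = subst StartsWithV (++-identityʳ Xw) (Y^n++-startsWithV S≥1 T [] (inj₁ refl))

  dense-U : 1 ≤ S → Dense U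
  dense-U S≥1 = Xw++ S≥1 Xw (dense-Xw S≥1) (Xw-startsWithV S≥1)

  dense-W : 1 ≤ S → 1 ≤ T → Dense W
  dense-W S≥1 T≥1 = go T T≥1
    where
    go : ∀ n → 1 ≤ n → Dense (pow Y n ++ a ++ Xw)
    go (suc n) _ = subst Dense (trans (sym (++-assoc (pow Y n) Y _)) (cong (_++ (a ++ Xw)) (sym (pow-suc-snoc Y n))))
      (dense-Y^n++ S≥1 n _ (dense-Y++ S≥1 a Xw (m≤m+n la lb) (dense-Xw S≥1) (Xw-startsWithV S≥1))
                           (Y++-startsWithV S≥1 _))

  1≤Lv : 1 ≤ r → 1 ≤ Lv
  1≤Lv r≥1 with occurs-in-v (aL (fromℕ< r≥1))
  ... | _ , _ , o<Lv , _ = ≤-<-trans z≤n o<Lv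

  S≤VL : 1 ≤ r → S ≤ VL
  S≤VL r≥1 = subst (S ≤_) (sym (length-pow v S)) (m≤m*n S Lv {{>-nonZero (1≤Lv r≥1)}})

  2VL+la≤Ly : VL + VL + la ≤ Ly
  2VL+la≤Ly = subst (VL + VL + la ≤_) (sym ∣Y∣≡)
    (≤-trans (≤-reflexive (xy∙z≈xz∙y VL VL la)) (≤-trans (≤-reflexive (+-assoc VL la VL))
      (+-monoʳ-≤ VL (+-monoʳ-≤ la (m≤m+n VL (lb + VL))))))
    where
    ∣Y∣≡ : Ly ≡ VL + (la + (VL + (lb + VL)))
    ∣Y∣≡ = trans (length-++ V) (cong (VL +_) (trans (length-++ a)
             (cong (la +_) (trans (length-++ V) (cong (VL +_) (length-++ b))))))

  1≤Ly : 1 ≤ r → 1 ≤ S → 1 ≤ Ly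
  1≤Ly r≥1 S≥1 =
    ≤-trans S≥1 (≤-trans (S≤VL r≥1) (≤-trans (m≤m+n VL VL) (≤-trans (m≤m+n _ la) 2VL+la≤Ly)))

  ∣Xw∣ : length Xw ≡ T * Ly
  ∣Xw∣ = length-pow Y T

  ∣U∣≡ : length U ≡ T * Ly + T * Ly
  ∣U∣≡ = trans (length-++ Xw) (cong₂ _+_ ∣Xw∣ ∣Xw∣)

  ∣W∣≡ : length W ≡ T * Ly + la + T * Ly
  ∣W∣≡ = trans (length-++ Xw) (trans (cong (length Xw +_) (length-++ a))
           (trans (sym (+-assoc (length Xw) la _)) (cong₂ (λ u w → u + la + w) ∣Xw∣ ∣Xw∣)))

  prefix-agree : ∀ x → x < T * Ly → letterAt U x ≡ letterAt W x
  prefix-agree x x< = letterAt-common-prefix Xw Xw (a ++ Xw) (subst (x <_) (sym ∣Xw∣) x<)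

  suffix-agree : ∀ i → letterAt U (T * Ly + i) ≡ letterAt W (T * Ly + la + i)
  suffix-agree i = begin
    letterAt U (T * Ly + i)            ≡⟨ cong (λ z → letterAt U (z + i)) ∣Xw∣ ⟨
    letterAt U (length Xw + i)         ≡⟨ letterAt-++ʳ Xw Xw i ⟩
    letterAt Xw i                      ≡⟨ letterAt-++ʳ a Xw i ⟨
    letterAt (a ++ Xw) (la + i)        ≡⟨ letterAt-++ʳ Xw (a ++ Xw) (la + i) ⟨
    letterAt W (length Xw + (la + i))  ≡⟨ cong (letterAt W) (+-assoc (length Xw) la i) ⟨
    letterAt W (length Xw + la + i)    ≡⟨ cong (λ z → letterAt W (z + la + i)) ∣Xw∣ ⟩
    letterAt W (T * Ly + la + i)       ∎

  U-periodic : ∀ x q → x + q * Ly < T * Ly + T * Ly → letterAt U (x + q * Ly) ≡ letterAt U x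
  U-periodic x q h = subst (λ w → letterAt w (x + q * Ly) ≡ letterAt w x) (sym (pow-+ Y T T))
    (pow-periodic* Y (T + T) x q (subst (x + q * Ly <_) (sym (*-distribʳ-+ Ly T T)) h))

  VaV++ : ∀ R → V ++ a ++ V ++ R ≡ (V ++ a ++ V) ++ R
  VaV++ R = sym (trans (++-assoc V (a ++ V) R) (cong (V ++_) (++-assoc a V R)))

  pow-Y-starts : ∀ n → 1 ≤ n → ∃ λ R → pow Y n ≡ V ++ a ++ V ++ R
  pow-Y-starts (suc n) _ = b ++ V ++ pow Y n , Y++≡ (pow Y n)

  pow-Y-ends : ∀ n → 1 ≤ n → ∃ λ Z → pow Y n ≡ Z ++ V
  pow-Y-ends (suc n) _ =
    pow Y n ++ (V ++ a ++ V ++ b) ,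
    trans (pow-suc-snoc Y n) (trans (cong (pow Y n ++_) Y≡) (sym (++-assoc (pow Y n) (V ++ a ++ V ++ b) V)))
    where
    Y≡ : Y ≡ (V ++ a ++ V ++ b) ++ V
    Y≡ = sym (trans (++-assoc V (a ++ V ++ b) V)
               (cong (V ++_) (trans (++-assoc a (V ++ b) V) (cong (a ++_) (++-assoc V b V)))))

  seam-agree : 1 ≤ T → ∀ i → i < VL + la + VL → letterAt W (T * Ly ∸ VL + i) ≡ letterAt U (T * Ly + i)
  seam-agree T≥1 i i< with pow-Y-ends T T≥1 | pow-Y-starts T T≥1
  ... | Z , Xw≡Z++V | R , Xw≡VaV++R = begin
    letterAt W (T * Ly ∸ VL + i)                  ≡⟨ cong (λ z → letterAt W (z + i)) σ∸VL≡∣Z∣ ⟩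
    letterAt W (length Z + i)                     ≡⟨ cong (λ w → letterAt w (length Z + i)) W≡ ⟩
    letterAt (Z ++ V ++ a ++ Xw) (length Z + i)   ≡⟨ letterAt-++ʳ Z _ i ⟩
    letterAt (V ++ a ++ Xw) i                     ≡⟨ cong (λ w → letterAt (V ++ a ++ w) i) Xw≡VaV++R ⟩
    letterAt (V ++ a ++ V ++ a ++ V ++ R) i       ≡⟨ cong (λ w → letterAt w i) (VaV++ (a ++ V ++ R)) ⟩
    letterAt ((V ++ a ++ V) ++ a ++ V ++ R) i     ≡⟨ letterAt-common-prefix (V ++ a ++ V) _ R i<∣VaV∣ ⟩
    letterAt ((V ++ a ++ V) ++ R) i               ≡⟨ cong (λ w → letterAt w i) (trans (sym (VaV++ R)) (sym Xw≡VaV++R)) ⟩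
    letterAt Xw i                                 ≡⟨ letterAt-++ʳ Xw Xw i ⟨
    letterAt U (length Xw + i)                    ≡⟨ cong (λ z → letterAt U (z + i)) ∣Xw∣ ⟩
    letterAt U (T * Ly + i)                       ∎
    where
    σ∸VL≡∣Z∣ : T * Ly ∸ VL ≡ length Z
    σ∸VL≡∣Z∣ = trans (cong (_∸ VL) (trans (sym ∣Xw∣) (trans (cong length Xw≡Z++V) (length-++ Z))))
                     (m+n∸n≡m (length Z) VL)
    W≡ : W ≡ Z ++ V ++ a ++ Xw
    W≡ = trans (cong (_++ (a ++ Xw)) Xw≡Z++V) (++-assoc Z V (a ++ Xw))
    i<∣VaV∣ : i < length (V ++ a ++ V)
    i<∣VaV∣ = subst (i <_) (trans (+-assoc VL la VL) (sym (trans (length-++ V) (cong (VL +_) (length-++ a)))))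
                    i<

lemma6p5 : (r s : ℕ) → 1 ≤ r → 1 ≤ s → (k : ℕ) →
    Σ ℕ λ R → (S T : ℕ) → 1 ≤ S → 1 ≤ T → R ≤ S → R ≤ T →
      (X r s S T ++ X r s S T) ≡[ k ] (X r s S T ++ aW r s ++ X r s S T)
lemma6p5 r s r≥1 _ k = R , λ S T S≥1 T≥1 R≤S R≤T → let open Words r s S T in
  PeriodicGame.game-≡ U W T Ly la D VL k {{>-nonZero (1≤Ly r≥1 S≥1)}}
    ∣U∣≡ ∣W∣≡ prefix-agree suffix-agree U-periodic (seam-agree T≥1) (dense-U S≥1) (dense-W S≥1 T≥1)
    (≤-trans (m≤m+n _ _) (≤-trans R≤S (S≤VL r≥1))) 2VL+la≤Ly
    (≤-trans (m≤n+m _ (radius D k + radius D k)) R≤T)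
  where
  open Alphabet r s using (D)
  R = radius D k + radius D k + (blocks k + 3)
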